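{- For every complex number $\alpha$, as formal power series in $x$, $$\sum_{n\ge1}x^n\sum_{\lambda\vdash n}\sum_{v\in\lambda}h_v^{\alpha}=\prod_{m\ge1}\frac1{1-x^m}\times\sum_{k\ge1}\frac{x^kk^{\alpha+1}}{1-x^k}.$$
   Context: $\lambda\vdash n$ means $\lambda$ is a partition of $n$ (weakly decreasing positive integers $\lambda_1\ge\cdots\ge\lambda_\ell$ summing to $n$). The boxes of $\lambda$ are the pairs $(i,j)$ with $1\le j\le \lambda_i$; the hook length of $v=(i,j)$ is $h_v=\lambda_i-j+\lambda'_j-i+1$ with $\lambda'_j=\#\{k:\lambda_k\ge j\}$. -}

module Defs where

open import Algebra.Bundles using (CommutativeRing)
import Data.Nat as N
open import Data.Nat using (ℕ; zero; suc; _∸_; _≤_; _<_; _≥_; _≤?_; _≟_)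
open import Data.Nat.Divisibility using (_∣?_)
open import Data.Bool using (if_then_else_)
open import Data.List using (List; []; _∷_; length; filter)
open import Data.Nat.ListAction using (sum)
open import Data.List.Relation.Unary.All using (All)
open import Data.List.Relation.Unary.Linked using (Linked)
open import Data.Product using (_×_)
open import Relation.Nullary.Decidable using (⌊_⌋)
open import Relation.Binary.PropositionalEquality using (_≡_)

IsPartitionOf : ℕ → List ℕ → Set
IsPartitionOf n μ = Linked _≥_ μ × All (0 <_) μ × sum μ ≡ n

conj : List ℕ → ℕ → ℕ
conj μ j = length (filter (λ r → j ≤? r) μ)

module _ {c ℓ} (R : CommutativeRing c ℓ) where
  open CommutativeRing R

  sumTo : ℕ → (ℕ → Carrier) → Carrier
  sumTo zero    g = 0#
  sumTo (suc n) g = sumTo n g + g n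

  -- Σ over the boxes (i,j) of μ of g(h_{(i,j)}), rows indexed from i = 1
  hookSumFrom : List ℕ → ℕ → List ℕ → (ℕ → Carrier) → Carrier
  hookSumFrom μ i []       g = 0#
  hookSumFrom μ i (r ∷ rs) g =
    sumTo r (λ j′ → g (suc ((r ∸ suc j′) N.+ (conj μ (suc j′) ∸ i))))
    + hookSumFrom μ (suc i) rs g

  hookSum : List ℕ → (ℕ → Carrier) → Carrier
  hookSum μ g = hookSumFrom μ 1 μ g

  hookSumList : List (List ℕ) → (ℕ → Carrier) → Carrier
  hookSumList []      g = 0#
  hookSumList (μ ∷ L) g = hookSum μ g + hookSumList L g

  FPS : Set c
  FPS = ℕ → Carrier

  _⊛_ : FPS → FPS → FPS
  (a ⊛ b) n = sumTo (suc n) (λ i → a i * b (n ∸ i))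

  one : FPS
  one zero    = 1#
  one (suc _) = 0#

  mono : ℕ → FPS
  mono k n = if ⌊ k ≟ n ⌋ then 1# else 0#

  natR : ℕ → Carrier
  natR zero    = 0#
  natR (suc k) = 1# + natR k

  -- 1/(1 - x^m) = Σ_{i ≥ 0} x^{m i}   (used for m ≥ 1)
  geo : ℕ → FPS
  geo m n = if ⌊ m ∣? n ⌋ then 1# else 0#

  prodGeo : ℕ → FPS
  prodGeo zero    = one
  prodGeo (suc N) = prodGeo N ⊛ geo (suc N)

  -- ∏_{m ≥ 1} 1/(1 - x^m): the coefficient of x^n only involves m ≤ n
  partGF : FPS
  partGF n = prodGeo n n

  -- given pw k = k^α, the term  x^k k^{α+1} / (1 - x^k)
  lambertTerm : (ℕ → Carrier) → ℕ → FPS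
  lambertTerm pw k = mono k ⊛ (λ n → (natR k * pw k) * geo k n)

  -- Σ_{k ≥ 1} x^k k^{α+1}/(1 - x^k): terms with k > n vanish at x^n
  lambertSum : (ℕ → Carrier) → FPS
  lambertSum pw n = sumTo n (λ i → lambertTerm pw (suc i) n)

  rhsCoeff : (ℕ → Carrier) → ℕ → Carrier
  rhsCoeff pw = partGF ⊛ lambertSum pw

module Submission where

open import Defs
open import Algebra.Bundles using (CommutativeRing)
open import Data.Nat using (ℕ)
open import Data.List using (List)
open import Data.List.Membership.Propositional using (_∈_)
open import Data.List.Relation.Unary.Unique.Propositional using (Unique)
open import Function.Bundles using (_⇔_)

-- Both sides equal Σ_k g(k) · k · W_k(n) with W_k(n) = Σ_{d ≥ 1} p(n − dk), so
-- the theorem reduces to a classical count: over all partitions of n there are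
-- exactly k · W_k(n) boxes of hook length k.  This is proved with boundary
-- words.  A partition in an N × N box is a word of N ones and N zeros, its size
-- is the number of inversions, and its hooks of length k are the pairs (1 at p,
-- 0 at p + k).  Exchanging the two letters of such a pair (HookSwap) trades the
-- hooks in words with m inversions for the "cohooks" (0 at p, 1 at p + k) in
-- words with m − k inversions, and a word with few inversions has exactly k
-- more cohooks than hooks.  Hence T(k + m) = T(m) + k · p(m) for the number
-- T(m) of hooks of length k over the partitions of m, the recursion solved by
-- k · W_k (HookTotals).

module Combinatorics where

  open import Data.Nat using (zero; suc; _+_; _*_; _∸_; _≤_; _<_; _≥_; z≤n; s≤s; s≤s⁻¹; _≟_; _≤?_; _≤ᵇ_)
  open import Data.Nat.Properties
  open import Algebra.Properties.CommutativeSemigroup +-commutativeSemigroup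
    using () renaming (interchange to +-interchange)
  open import Data.Nat.Divisibility using (_∣?_; ∣⇒≤; _∣0; n∣n; ∣m∣n⇒∣m+n; ∣m+n∣m⇒∣n)
  open import Data.Nat.ListAction using (sum)
  open import Data.Nat.ListAction.Properties using (sum-↭; sum-++)
  open import Data.Nat.Tactic.RingSolver using (solve-∀)
  open import Data.Bool using (Bool; true; false; if_then_else_)
  open import Data.Maybe using (Maybe; just; nothing)
  open import Data.List using ([]; _∷_; _++_; map; length; take; drop; replicate; downFrom; filter)
  open import Data.List.Properties using (take-all; ∷-injectiveʳ; map-++; map-∘; map-id; ++-identityʳ)
  open import Data.List.Membership.Propositional.Properties
    using (∈-map⁺; ∈-map⁻; ∈-++⁺ˡ; ∈-++⁺ʳ; ∈-++⁻; ∈-filter⁺; ∈-filter⁻)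
  open import Data.List.Membership.Propositional.Properties.WithK using (unique∧set⇒bag)
  open import Data.List.Relation.Binary.BagAndSetEquality using (∼bag⇒↭)
  import Data.List.Relation.Binary.Permutation.Propositional.Properties as Perm
  open import Data.List.Relation.Unary.Any using (here; there)
  open import Data.List.Relation.Unary.All using (All; []; _∷_)
  import Data.List.Relation.Unary.All.Properties as AllP
  open import Data.List.Relation.Unary.AllPairs using ([]; _∷_)
  open import Data.List.Relation.Unary.Linked using (Linked; []; [-]; _∷_) renaming (tail to linked-tail)
  open import Data.List.Relation.Unary.Linked.Properties using (Linked⇒AllPairs)
  import Data.List.Relation.Unary.Unique.Propositional.Properties as UniqueP
  open import Data.Product using (_×_; _,_; proj₁; proj₂)
  open import Data.Sum using (_⊎_; inj₁; inj₂)
  open import Data.Empty using (⊥-elim)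
  open import Function.Bundles using (Equivalence; mk⇔)
  open import Relation.Binary.PropositionalEquality
  open import Relation.Nullary using (Dec; yes; no; ¬_)
  open import Relation.Nullary.Decidable using (⌊_⌋)

  sumOver : ∀ {a} {X : Set a} → (X → ℕ) → List X → ℕ
  sumOver f xs = sum (map f xs)

  -- Duplicate-free lists with the same members are permutations of each
  -- other, so every sum over them agrees.  This is how bijections are used.
  sumOver-unique : ∀ {a} {X : Set a} (f : X → ℕ) (xs ys : List X) → Unique xs → Unique ys →
    (∀ z → z ∈ xs → z ∈ ys) → (∀ z → z ∈ ys → z ∈ xs) → sumOver f xs ≡ sumOver f ys
  sumOver-unique f xs ys ux uy to from =
    sum-↭ (Perm.map⁺ f (∼bag⇒↭ (unique∧set⇒bag ux uy (mk⇔ (to _) (from _)))))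

  sumOver-cong : ∀ {a} {X : Set a} (ws : List X) {f g : X → ℕ} →
    (∀ w → w ∈ ws → f w ≡ g w) → sumOver f ws ≡ sumOver g ws
  sumOver-cong [] h = refl
  sumOver-cong (w ∷ ws) h = cong₂ _+_ (h w (here refl)) (sumOver-cong ws (λ v m → h v (there m)))

  sumOver-+ : ∀ {a} {X : Set a} (ws : List X) (f g : X → ℕ) →
    sumOver (λ w → f w + g w) ws ≡ sumOver f ws + sumOver g ws
  sumOver-+ [] f g = refl
  sumOver-+ (w ∷ ws) f g =
    trans (cong (f w + g w +_) (sumOver-+ ws f g)) (+-interchange (f w) (g w) (sumOver f ws) (sumOver g ws))

  sumOver-*ˡ : ∀ {a} {X : Set a} (ws : List X) c (f : X → ℕ) → c * sumOver f ws ≡ sumOver (λ w → c * f w) ws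
  sumOver-*ˡ [] c f = *-zeroʳ c
  sumOver-*ˡ (w ∷ ws) c f = trans (*-distribˡ-+ c (f w) (sumOver f ws)) (cong (c * f w +_) (sumOver-*ˡ ws c f))

  sumOver-map : ∀ {a b} {X : Set a} {Y : Set b} (ws : List X) (σ : X → Y) (f : Y → ℕ) →
    sumOver f (map σ ws) ≡ sumOver (λ w → f (σ w)) ws
  sumOver-map ws σ f = cong sum (sym (map-∘ ws))

  sumOver-++ : ∀ {a} {X : Set a} (xs ys : List X) (f : X → ℕ) → sumOver f (xs ++ ys) ≡ sumOver f xs + sumOver f ys
  sumOver-++ xs ys f = trans (cong sum (map-++ f xs ys)) (sum-++ (map f xs) (map f ys))

  sumOver-filter : ∀ {a p} {X : Set a} {P : X → Set p} (P? : ∀ x → Dec (P x)) (f : X → ℕ) xs →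
    (∀ x → ¬ P x → f x ≡ 0) → sumOver f (filter P? xs) ≡ sumOver f xs
  sumOver-filter P? f [] h = refl
  sumOver-filter P? f (x ∷ xs) h with P? x
  ... | yes _ = cong (f x +_) (sumOver-filter P? f xs h)
  ... | no ¬px = trans (sumOver-filter P? f xs h) (sym (cong (_+ sumOver f xs) (h x ¬px)))

  map-unique-on : ∀ {a b} {X : Set a} {Y : Set b} (f : X → Y) (xs : List X) →
    (∀ x y → x ∈ xs → y ∈ xs → f x ≡ f y → x ≡ y) → Unique xs → Unique (map f xs)
  map-unique-on f [] inj [] = []
  map-unique-on f (x ∷ xs) inj (x∉xs ∷ u) =
    separated xs x∉xs (λ y y∈xs → inj x y (here refl) (there y∈xs))
    ∷ map-unique-on f xs (λ a b a∈ b∈ → inj a b (there a∈) (there b∈)) u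
    where
    separated : ∀ ys → All (λ y → ¬ x ≡ y) ys → (∀ y → y ∈ ys → f x ≡ f y → x ≡ y) →
                All (λ z → ¬ f x ≡ z) (map f ys)
    separated [] [] h = []
    separated (y ∷ ys) (p ∷ ps) h = (λ e → p (h y (here refl) e)) ∷ separated ys ps (λ z m → h z (there m))

  sumBelow : ℕ → (ℕ → ℕ) → ℕ
  sumBelow zero f = 0
  sumBelow (suc n) f = sumBelow n f + f n

  sumBelow-cong : ∀ n {f g : ℕ → ℕ} → (∀ i → i < n → f i ≡ g i) → sumBelow n f ≡ sumBelow n g
  sumBelow-cong zero h = refl
  sumBelow-cong (suc n) h = cong₂ _+_ (sumBelow-cong n (λ i lt → h i (m≤n⇒m≤1+n lt))) (h n ≤-refl)

  sumBelow-first : ∀ n f → sumBelow (suc n) f ≡ f 0 + sumBelow n (λ i → f (suc i))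
  sumBelow-first zero f = +-comm 0 (f 0)
  sumBelow-first (suc n) f = trans (cong (_+ f (suc n)) (sumBelow-first n f)) (+-assoc (f 0) _ _)

  sumBelow-+ : ∀ n f g → sumBelow n (λ i → f i + g i) ≡ sumBelow n f + sumBelow n g
  sumBelow-+ zero f g = refl
  sumBelow-+ (suc n) f g =
    trans (cong (_+ (f n + g n)) (sumBelow-+ n f g)) (+-interchange (sumBelow n f) (sumBelow n g) (f n) (g n))

  sumBelow-*ˡ : ∀ n c f → c * sumBelow n f ≡ sumBelow n (λ i → c * f i)
  sumBelow-*ˡ zero c f = *-zeroʳ c
  sumBelow-*ˡ (suc n) c f = trans (*-distribˡ-+ c (sumBelow n f) (f n)) (cong (_+ c * f n) (sumBelow-*ˡ n c f))

  sumBelow-0 : ∀ n f → (∀ i → i < n → f i ≡ 0) → sumBelow n f ≡ 0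
  sumBelow-0 zero f h = refl
  sumBelow-0 (suc n) f h = cong₂ _+_ (sumBelow-0 n f (λ i lt → h i (m≤n⇒m≤1+n lt))) (h n ≤-refl)

  sumBelow-split : ∀ a b f → sumBelow (a + b) f ≡ sumBelow a f + sumBelow b (λ i → f (a + i))
  sumBelow-split a zero f = trans (cong (λ z → sumBelow z f) (+-identityʳ a)) (sym (+-identityʳ _))
  sumBelow-split a (suc b) f = trans (cong (λ z → sumBelow z f) (+-suc a b))
    (trans (cong (_+ f (a + b)) (sumBelow-split a b f)) (+-assoc (sumBelow a f) _ _))

  sumOver-sumBelow : ∀ {a} {X : Set a} (ws : List X) n (f : X → ℕ → ℕ) →
    sumOver (λ w → sumBelow n (f w)) ws ≡ sumBelow n (λ p → sumOver (λ w → f w p) ws)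
  sumOver-sumBelow [] n f = sym (sumBelow-0 n _ (λ _ _ → refl))
  sumOver-sumBelow (w ∷ ws) n f = trans (cong (sumBelow n (f w) +_) (sumOver-sumBelow ws n f))
    (sym (sumBelow-+ n (f w) (λ p → sumOver (λ v → f v p) ws)))

  δ : ℕ → ℕ → ℕ
  δ m n = if ⌊ m ≟ n ⌋ then 1 else 0

  δ-refl : ∀ m → δ m m ≡ 1
  δ-refl m with m ≟ m
  ... | yes _ = refl
  ... | no ne = ⊥-elim (ne refl)

  δ-ne : ∀ m n → ¬ m ≡ n → δ m n ≡ 0
  δ-ne m n ne with m ≟ n
  ... | yes e = ⊥-elim (ne e)
  ... | no _ = refl

  δ-+ : ∀ k m n → δ (k + m) (k + n) ≡ δ m n
  δ-+ k m n with m ≟ n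
  ... | yes refl = δ-refl (k + m)
  ... | no ne = δ-ne _ _ (λ e → ne (+-cancelˡ-≡ k m n e))

  δ-suc : ∀ x y → δ (suc x) (suc y) ≡ δ x y
  δ-suc = δ-+ 1

  δ-case : ∀ a b X Y → (a ≡ b → X ≡ Y) → δ a b * X ≡ δ a b * Y
  δ-case a b X Y h with a ≟ b
  ... | yes e = cong (_+ 0) (h e)
  ... | no _ = refl

  count : ℕ → List ℕ → ℕ
  count x = sumOver (δ x)

  count-map-suc : ∀ x l → count (suc x) (map suc l) ≡ count x l
  count-map-suc x [] = refl
  count-map-suc x (y ∷ l) = cong₂ _+_ (δ-suc x y) (count-map-suc x l)

  count-0-suc : ∀ l → count 0 (map suc l) ≡ 0
  count-0-suc [] = refl
  count-0-suc (y ∷ l) = count-0-suc l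

  count-++ : ∀ x l l' → count x (l ++ l') ≡ count x l + count x l'
  count-++ x l l' = sumOver-++ l l' (δ x)

  -- A partition fitting in a box is encoded by its boundary
  -- word (true = 1 = a row end, false = 0 = a column step); its size is the
  -- number of inversions (a 1 before a 0) and its hook lengths are the
  -- distances q − p of the pairs (1 at p, 0 at q > p).

  bit : Bool → ℕ
  bit true = 1
  bit false = 0

  notBit : Bool → ℕ
  notBit true = 0
  notBit false = 1

  ones : List Bool → ℕ
  ones [] = 0
  ones (c ∷ w) = bit c + ones w

  zeros : List Bool → ℕ
  zeros [] = 0
  zeros (c ∷ w) = notBit c + zeros w

  inv : List Bool → ℕ
  inv [] = 0
  inv (false ∷ w) = inv w
  inv (true ∷ w) = zeros w + inv w

  get : List Bool → ℕ → Maybe Bool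
  get [] _ = nothing
  get (c ∷ w) zero = just c
  get (c ∷ w) (suc i) = get w i

  set : List Bool → ℕ → Bool → List Bool
  set [] _ _ = []
  set (c ∷ w) zero c' = c' ∷ w
  set (c ∷ w) (suc i) c' = c ∷ set w i c'

  isOne : Maybe Bool → ℕ
  isOne (just true) = 1
  isOne _ = 0

  isZero : Maybe Bool → ℕ
  isZero (just false) = 1
  isZero _ = 0

  oneAt : List Bool → ℕ → ℕ
  oneAt w p = isOne (get w p)

  zeroAt : List Bool → ℕ → ℕ
  zeroAt w p = isZero (get w p)

  get-set-same : ∀ w i {c0} c → get w i ≡ just c0 → get (set w i c) i ≡ just c
  get-set-same (x ∷ w) zero c e = refl
  get-set-same (x ∷ w) (suc i) c e = get-set-same w i c e

  set-set : ∀ w i c c' → set (set w i c) i c' ≡ set w i c'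
  set-set [] i c c' = refl
  set-set (x ∷ w) zero c c' = refl
  set-set (x ∷ w) (suc i) c c' = cong (x ∷_) (set-set w i c c')

  set-get : ∀ w i c → get w i ≡ just c → set w i c ≡ w
  set-get (x ∷ w) zero c refl = refl
  set-get (x ∷ w) (suc i) c e = cong (x ∷_) (set-get w i c e)

  +-comm-outer : ∀ a b c → (a + b) + c ≡ (c + b) + a
  +-comm-outer = solve-∀

  ones-set : ∀ w i {c0} c → get w i ≡ just c0 → ones (set w i c) + bit c0 ≡ ones w + bit c
  ones-set (x ∷ w) zero c refl = +-comm-outer (bit c) (ones w) (bit x)
  ones-set (x ∷ w) (suc i) {c0} c e = trans (+-assoc (bit x) _ (bit c0))
    (trans (cong (bit x +_) (ones-set w i c e)) (sym (+-assoc (bit x) (ones w) (bit c))))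

  zeros-set : ∀ w i {c0} c → get w i ≡ just c0 → zeros (set w i c) + notBit c0 ≡ zeros w + notBit c
  zeros-set (x ∷ w) zero c refl = +-comm-outer (notBit c) (zeros w) (notBit x)
  zeros-set (x ∷ w) (suc i) {c0} c e = trans (+-assoc (notBit x) _ (notBit c0))
    (trans (cong (notBit x +_) (zeros-set w i c e)) (sym (+-assoc (notBit x) (zeros w) (notBit c))))

  -- Turning the 0 at position d into a 1 removes the inversions it formed
  -- with the d letters before it and creates one with every later 0.
  inv-set : ∀ v d → get v d ≡ just false → inv (set v d true) + suc d ≡ inv v + zeros v
  inv-set (false ∷ v) zero refl = h (zeros v) (inv v)
    where h : ∀ a b → a + b + 1 ≡ b + suc a
          h = solve-∀
  inv-set (false ∷ v) (suc d) e = trans (+-suc (inv (set v d true)) (suc d))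
    (trans (cong suc (inv-set v d e)) (sym (+-suc (inv v) (zeros v))))
  inv-set (true ∷ v) (suc d) e =
    begin
      zeros (set v d true) + inv (set v d true) + suc (suc d)
    ≡⟨ +-assoc (zeros (set v d true)) _ _ ⟩
      zeros (set v d true) + (inv (set v d true) + suc (suc d))
    ≡⟨ cong (zeros (set v d true) +_) (+-suc (inv (set v d true)) (suc d)) ⟩
      zeros (set v d true) + suc (inv (set v d true) + suc d)
    ≡⟨ +-suc (zeros (set v d true)) _ ⟩
      suc (zeros (set v d true)) + (inv (set v d true) + suc d)
    ≡⟨ cong₂ _+_ (trans (+-comm 1 _) (trans (zeros-set v d true e) (+-identityʳ (zeros v)))) (inv-set v d e) ⟩
      zeros v + (inv v + zeros v)
    ≡⟨ sym (+-assoc (zeros v) (inv v) (zeros v)) ⟩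
      zeros v + inv v + zeros v
    ∎
    where open ≡-Reasoning

  ones+zeros : ∀ w → ones w + zeros w ≡ length w
  ones+zeros [] = refl
  ones+zeros (true ∷ w) = cong suc (ones+zeros w)
  ones+zeros (false ∷ w) = trans (+-suc (ones w) (zeros w)) (cong suc (ones+zeros w))

  Words : ℕ → ℕ → List (List Bool)
  Words zero zero = [] ∷ []
  Words zero (suc b) = map (false ∷_) (Words zero b)
  Words (suc a) zero = map (true ∷_) (Words a zero)
  Words (suc a) (suc b) = map (true ∷_) (Words a (suc b)) ++ map (false ∷_) (Words (suc a) b)

  Words-sound : ∀ a b w → w ∈ Words a b → ones w ≡ a × zeros w ≡ b
  Words-sound zero zero .[] (here refl) = refl , refl
  Words-sound zero (suc b) w m with ∈-map⁻ (false ∷_) m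
  ... | v , mv , refl = let (p , q) = Words-sound zero b v mv in p , cong suc q
  Words-sound (suc a) zero w m with ∈-map⁻ (true ∷_) m
  ... | v , mv , refl = let (p , q) = Words-sound a zero v mv in cong suc p , q
  Words-sound (suc a) (suc b) w m with ∈-++⁻ (map (true ∷_) (Words a (suc b))) m
  ... | inj₁ m1' with ∈-map⁻ (true ∷_) m1'
  ...   | v , mv , refl = let (p , q) = Words-sound a (suc b) v mv in cong suc p , q
  Words-sound (suc a) (suc b) w m | inj₂ m2 with ∈-map⁻ (false ∷_) m2
  ...   | v , mv , refl = let (p , q) = Words-sound (suc a) b v mv in p , cong suc q

  Words-complete : ∀ w → w ∈ Words (ones w) (zeros w)
  Words-complete [] = here refl
  Words-complete (true ∷ w) with zeros w | Words-complete w
  ... | zero | m = ∈-map⁺ (true ∷_) m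
  ... | suc z | m = ∈-++⁺ˡ (∈-map⁺ (true ∷_) m)
  Words-complete (false ∷ w) with ones w | Words-complete w
  ... | zero | m = ∈-map⁺ (false ∷_) m
  ... | suc o | m = ∈-++⁺ʳ (map (true ∷_) (Words o (suc (zeros w)))) (∈-map⁺ (false ∷_) m)

  Words-in : ∀ a b w → ones w ≡ a → zeros w ≡ b → w ∈ Words a b
  Words-in a b w refl refl = Words-complete w

  Words-unique : ∀ a b → Unique (Words a b)
  Words-unique zero zero = [] ∷ []
  Words-unique zero (suc b) = UniqueP.map⁺ ∷-injectiveʳ (Words-unique zero b)
  Words-unique (suc a) zero = UniqueP.map⁺ ∷-injectiveʳ (Words-unique a zero)
  Words-unique (suc a) (suc b) = UniqueP.++⁺ (UniqueP.map⁺ ∷-injectiveʳ (Words-unique a (suc b)))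
    (UniqueP.map⁺ ∷-injectiveʳ (Words-unique (suc a) b)) dis
    where
    dis : ∀ {v} → ¬ (v ∈ map (true ∷_) (Words a (suc b)) × v ∈ map (false ∷_) (Words (suc a) b))
    dis (m1' , m2) with ∈-map⁻ (true ∷_) m1' | ∈-map⁻ (false ∷_) m2
    ... | _ , _ , refl | _ , _ , ()

  get-out : ∀ w i → length w ≤ i → get w i ≡ nothing
  get-out [] i le = refl
  get-out (c ∷ w) (suc i) (s≤s le) = get-out w i le

  isOne+isZero : ∀ w i → i < length w → isOne (get w i) + isZero (get w i) ≡ 1
  isOne+isZero (true ∷ w) zero lt = refl
  isOne+isZero (false ∷ w) zero lt = refl
  isOne+isZero (c ∷ w) (suc i) (s≤s lt) = isOne+isZero w i lt

  ones-take-suc : ∀ j w → ones (take (suc j) w) ≡ ones (take j w) + isOne (get w j)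
  ones-take-suc zero [] = refl
  ones-take-suc (suc j) [] = refl
  ones-take-suc zero (true ∷ w) = refl
  ones-take-suc zero (false ∷ w) = refl
  ones-take-suc (suc j) (c ∷ w) = trans (cong (bit c +_) (ones-take-suc j w)) (sym (+-assoc (bit c) _ _))

  zeros-drop : ∀ i w → zeros (drop i w) ≤ zeros w
  zeros-drop zero w = ≤-refl
  zeros-drop (suc i) [] = ≤-refl
  zeros-drop (suc i) (c ∷ w) = ≤-trans (zeros-drop i w) (m≤n+m (zeros w) (notBit c))

  -- A word with few inversions compared to its zeros (ones) must begin
  -- with j zeros (end with j ones): a 1 among the first j letters would
  -- already form inversions with all the zeros after it.
  leading-zeros : ∀ j w → inv w + j ≤ zeros w → ones (take j w) ≡ 0
  leading-zeros zero w le = refl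
  leading-zeros (suc j) [] le = refl
  leading-zeros (suc j) (false ∷ w) le = leading-zeros j w (s≤s⁻¹ (subst (_≤ suc (zeros w)) (+-suc (inv w) j) le))
  leading-zeros (suc j) (true ∷ w) le = ⊥-elim (n≮n (zeros w) (<-≤-trans lt le))
    where lt : zeros w < zeros w + inv w + suc j
          lt = ≤-<-trans (m≤m+n (zeros w) (inv w)) (m<m+n (zeros w + inv w) (s≤s z≤n))

  zeros≡0 : ∀ w → length w ≤ ones w → zeros w ≡ 0
  zeros≡0 w le = n≤0⇒n≡0 (+-cancelˡ-≤ (ones w) _ _ (≤-trans (≤-reflexive (ones+zeros w)) (≤-trans le (≤-reflexive (sym (+-identityʳ (ones w)))))))

  trailing-ones : ∀ j w → inv w + j ≤ ones w → zeros (drop (length w ∸ j) w) ≡ 0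
  trailing-ones zero [] le = refl
  trailing-ones (suc j) [] le = refl
  trailing-ones j (c ∷ w) le with j ≤? length w
  ... | yes jl rewrite +-∸-assoc 1 jl = onTail c le
    where
    onTail : ∀ c → inv (c ∷ w) + j ≤ ones (c ∷ w) → zeros (drop (length w ∸ j) w) ≡ 0
    onTail false le = trailing-ones j w le
    onTail true le with zeros w in eq
    ... | zero = n≤0⇒n≡0 (≤-trans (zeros-drop (length w ∸ j) w) (≤-reflexive eq))
    ... | suc z = trailing-ones j w (s≤s⁻¹ (≤-trans (s≤s (≤-trans (m≤n+m (inv w + j) z) (≤-reflexive (sym (+-assoc z (inv w) j))))) le))
  ... | no jl = subst (λ x → zeros (drop x (c ∷ w)) ≡ 0) (sym (m≤n⇒m∸n≡0 (≰⇒> jl))) (zeros≡0 (c ∷ w) lenle)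
    where lenle : length (c ∷ w) ≤ ones (c ∷ w)
          lenle = ≤-trans (≰⇒> jl) (≤-trans (m≤n+m j (inv (c ∷ w))) le)

  isZero-01 : ∀ x → isZero x ≡ 0 ⊎ isZero x ≡ 1
  isZero-01 (just true) = inj₁ refl
  isZero-01 (just false) = inj₂ refl
  isZero-01 nothing = inj₁ refl

  isOne-01 : ∀ x → isOne x ≡ 0 ⊎ isOne x ≡ 1
  isOne-01 (just true) = inj₂ refl
  isOne-01 (just false) = inj₁ refl
  isOne-01 nothing = inj₁ refl

  -- A hook at p is a 1 at p
  -- followed by a 0 at p + k; a cohook is a 0 at p followed by a 1 at p + k.
  -- Exchanging the two letters turns a cohook of w into a hook of a word
  -- with k more inversions, and conversely.
  module HookSwap (t : ℕ) where
    k : ℕ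
    k = suc t

    -- swapAt p exchanges the letters at positions p and p + k
    swapStep : Bool → List Bool → Maybe Bool → List Bool
    swapStep c w (just c') = c' ∷ set w t c
    swapStep c w nothing = c ∷ w

    swapAt : ℕ → List Bool → List Bool
    swapAt zero [] = []
    swapAt zero (c ∷ w) = swapStep c w (get w t)
    swapAt (suc p) [] = []
    swapAt (suc p) (c ∷ w) = c ∷ swapAt p w

    hookAt : List Bool → ℕ → ℕ
    hookAt w p = oneAt w p * zeroAt w (p + k)

    coHookAt : List Bool → ℕ → ℕ
    coHookAt w p = zeroAt w p * oneAt w (p + k)

    swapAt-involutive : ∀ p w → swapAt p (swapAt p w) ≡ w
    swapAt-involutive zero [] = refl
    swapAt-involutive zero (c ∷ w) with get w t in eq
    ... | nothing rewrite eq = refl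
    ... | just c' rewrite get-set-same w t c eq = cong (c ∷_) (trans (set-set w t c c') (set-get w t c' eq))
    swapAt-involutive (suc p) [] = refl
    swapAt-involutive (suc p) (c ∷ w) = cong (c ∷_) (swapAt-involutive p w)

    ones-swapAt : ∀ p w → ones (swapAt p w) ≡ ones w
    ones-swapAt zero [] = refl
    ones-swapAt zero (c ∷ w) with get w t in eq
    ... | nothing = refl
    ... | just c' = trans (+-comm (bit c') _) (trans (ones-set w t c eq) (+-comm (ones w) (bit c)))
    ones-swapAt (suc p) [] = refl
    ones-swapAt (suc p) (c ∷ w) = cong (bit c +_) (ones-swapAt p w)

    zeros-swapAt : ∀ p w → zeros (swapAt p w) ≡ zeros w
    zeros-swapAt zero [] = refl
    zeros-swapAt zero (c ∷ w) with get w t in eq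
    ... | nothing = refl
    ... | just c' = trans (+-comm (notBit c') _) (trans (zeros-set w t c eq) (+-comm (zeros w) (notBit c)))
    zeros-swapAt (suc p) [] = refl
    zeros-swapAt (suc p) (c ∷ w) = cong (notBit c +_) (zeros-swapAt p w)

    hookAt-swapAt : ∀ p w → hookAt (swapAt p w) p ≡ coHookAt w p
    hookAt-swapAt zero [] = refl
    hookAt-swapAt zero (c ∷ w) with get w t in eq
    ... | nothing rewrite eq = trans (*-zeroʳ (isOne (just c))) (sym (*-zeroʳ (isZero (just c))))
    ... | just c' rewrite get-set-same w t c eq = *-comm (isOne (just c')) (isZero (just c))
    hookAt-swapAt (suc p) [] = refl
    hookAt-swapAt (suc p) (c ∷ w) = hookAt-swapAt p w

    inv-swapAt : ∀ p w → coHookAt w p ≡ 1 → inv (swapAt p w) ≡ inv w + k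
    inv-swapAt zero (true ∷ w) ()
    inv-swapAt zero (false ∷ w) e with get w t in eq
    inv-swapAt zero (false ∷ w) () | nothing
    inv-swapAt zero (false ∷ w) () | just false
    ... | just true =
      let v = set w t false
          gv : get v t ≡ just false
          gv = get-set-same w t false eq
          r : inv (set v t true) + suc t ≡ inv v + zeros v
          r = inv-set v t gv
          r' : inv w + suc t ≡ inv v + zeros v
          r' = trans (cong (λ z → inv z + suc t) (sym (trans (set-set w t false true) (set-get w t true eq)))) r
      in trans (+-comm (zeros v) (inv v)) (sym r')
    inv-swapAt (suc p) [] ()
    inv-swapAt (suc p) (false ∷ w) e = inv-swapAt p w e
    inv-swapAt (suc p) (true ∷ w) e = trans (cong₂ _+_ (zeros-swapAt p w) (inv-swapAt p w e)) (sym (+-assoc (zeros w) (inv w) k))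

    hooks : List Bool → ℕ
    hooks [] = 0
    hooks (c ∷ w) = hookAt (c ∷ w) 0 + hooks w

    coHooks : List Bool → ℕ
    coHooks [] = 0
    coHooks (c ∷ w) = coHookAt (c ∷ w) 0 + coHooks w

    hooks-sum : ∀ w → hooks w ≡ sumBelow (length w) (hookAt w)
    hooks-sum [] = refl
    hooks-sum (c ∷ w) = trans (cong (hookAt (c ∷ w) 0 +_) (hooks-sum w)) (sym (sumBelow-first (length w) (hookAt (c ∷ w))))

    coHooks-sum : ∀ w → coHooks w ≡ sumBelow (length w) (coHookAt w)
    coHooks-sum [] = refl
    coHooks-sum (c ∷ w) = trans (cong (coHookAt (c ∷ w) 0 +_) (coHooks-sum w)) (sym (sumBelow-first (length w) (coHookAt (c ∷ w))))

    hooks-short : ∀ w → length w ≤ k → hooks w ≡ 0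
    hooks-short [] le = refl
    hooks-short (c ∷ w) (s≤s le) rewrite get-out w t le = trans (cong (_+ hooks w) (*-zeroʳ (isOne (just c)))) (hooks-short w (m≤n⇒m≤1+n le))

    coHooks-short : ∀ w → length w ≤ k → coHooks w ≡ 0
    coHooks-short [] le = refl
    coHooks-short (c ∷ w) (s≤s le) rewrite get-out w t le = trans (cong (_+ coHooks w) (*-zeroʳ (isZero (just c)))) (coHooks-short w (m≤n⇒m≤1+n le))

    -- Counting the pairs (w_p, w_{p+k}): cohooks minus hooks equals the ones
    -- among the last k letters minus the ones among the first k letters.
    -- Base case: a word of length exactly k.
    coHooks-ends-base : ∀ w → length w ≡ k →
      coHooks w + ones (take k w) + zeros (drop (length w ∸ k) w) ≡ hooks w + k
    coHooks-ends-base w eqL =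
      begin
        coHooks w + ones (take k w) + zeros (drop (length w ∸ k) w)
      ≡⟨ cong₂ (λ a b → a + b + zeros (drop (length w ∸ k) w))
               (coHooks-short w (≤-reflexive eqL)) (cong ones (take-all k w (≤-reflexive eqL))) ⟩
        ones w + zeros (drop (length w ∸ k) w)
      ≡⟨ cong (λ x → ones w + zeros (drop x w)) (trans (cong (_∸ k) eqL) (n∸n≡0 k)) ⟩
        ones w + zeros w
      ≡⟨ trans (ones+zeros w) eqL ⟩
        k
      ≡⟨ cong (_+ k) (sym (hooks-short w (≤-reflexive eqL))) ⟩
        hooks w + k
      ∎
      where open ≡-Reasoning

    -- Inductive step: prepending a letter c adds a cohook/hook at 0 exactly
    -- when c differs from the letter at position k.
    coHooks-ends : ∀ w → k ≤ length w → coHooks w + ones (take k w) + zeros (drop (length w ∸ k) w) ≡ hooks w + k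
    coHooks-ends (c ∷ w) le with k ≤? length w
    ... | no kl = coHooks-ends-base (c ∷ w) (≤-antisym (≰⇒> kl) le)
    ... | yes kl rewrite +-∸-assoc 1 kl = step c
      where
      O = ones (take t w)
      X = isOne (get w t)
      Y = isZero (get w t)
      Z = zeros (drop (length w ∸ k) w)
      XY : X + Y ≡ 1
      XY = isOne+isZero w t kl
      IH : coHooks w + (O + X) + Z ≡ hooks w + k
      IH = trans (cong (λ x → coHooks w + x + Z) (sym (ones-take-suc t w))) (coHooks-ends w kl)
      step : ∀ c → coHooks (c ∷ w) + ones (take k (c ∷ w)) + Z ≡ hooks (c ∷ w) + k
      step false = trans (h (coHooks w) O X Z) IH
        where h : ∀ a o x z → (x + 0 + a) + (0 + o) + z ≡ a + (o + x) + z
              h = solve-∀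
      step true =
        begin
          (0 + coHooks w) + (1 + O) + Z
        ≡⟨ h1 (coHooks w) O Z ⟩
          coHooks w + O + Z + 1
        ≡⟨ cong (coHooks w + O + Z +_) (sym XY) ⟩
          coHooks w + O + Z + (X + Y)
        ≡⟨ h2 (coHooks w) O Z X Y ⟩
          (coHooks w + (O + X) + Z) + Y
        ≡⟨ cong (_+ Y) IH ⟩
          hooks w + k + Y
        ≡⟨ h3 (hooks w) k Y ⟩
          (Y + 0 + hooks w) + k
        ∎
        where
        open ≡-Reasoning
        h1 : ∀ a o z → (0 + a) + (1 + o) + z ≡ a + o + z + 1
        h1 = solve-∀
        h2 : ∀ a o z x y → a + o + z + (x + y) ≡ (a + (o + x) + z) + y
        h2 = solve-∀
        h3 : ∀ a b y → a + b + y ≡ (y + 0 + a) + b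
        h3 = solve-∀

    -- For a word whose inversions are few compared with both its zeros and
    -- its ones, it starts with k zeros and ends with k ones, so it has
    -- exactly k more cohooks than hooks.
    coHooks≡hooks+k : ∀ w → inv w + k ≤ zeros w → inv w + k ≤ ones w → coHooks w ≡ hooks w + k
    coHooks≡hooks+k w fewZeros fewOnes =
      begin
        coHooks w
      ≡⟨ sym (trans (+-identityʳ _) (+-identityʳ _)) ⟩
        coHooks w + 0 + 0
      ≡⟨ sym (cong₂ (λ a b → coHooks w + a + b) (leading-zeros k w fewZeros) (trailing-ones k w fewOnes)) ⟩
        coHooks w + ones (take k w) + zeros (drop (length w ∸ k) w)
      ≡⟨ coHooks-ends w k≤length ⟩
        hooks w + k
      ∎
      where
      open ≡-Reasoning
      k≤length : k ≤ length w
      k≤length = ≤-trans (m≤n+m k (inv w))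
                   (≤-trans fewOnes (≤-trans (m≤m+n (ones w) (zeros w)) (≤-reflexive (ones+zeros w))))

    coHookAt-01 : ∀ w p → coHookAt w p ≡ 0 ⊎ coHookAt w p ≡ 1
    coHookAt-01 w p with isZero-01 (get w p) | isOne-01 (get w (p + k))
    ... | inj₁ e | _ = inj₁ (trans (cong (_* isOne (get w (p + k))) e) refl)
    ... | inj₂ e | inj₁ e' = inj₁ (trans (cong₂ _*_ e e') refl)
    ... | inj₂ e | inj₂ e' = inj₂ (trans (cong₂ _*_ e e') refl)

    swap-pointwise : ∀ m w p → δ (inv (swapAt p w)) m * hookAt (swapAt p w) p ≡ δ (inv w + k) m * coHookAt w p
    swap-pointwise m w p rewrite hookAt-swapAt p w with coHookAt-01 w p
    ... | inj₁ e rewrite e = trans (*-zeroʳ (δ (inv (swapAt p w)) m)) (sym (*-zeroʳ (δ (inv w + k) m)))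
    ... | inj₂ e rewrite e | inv-swapAt p w e = refl

    -- Since swapAt p permutes Words a b, the number of hooks at p in words
    -- with m inversions equals the number of cohooks at p in words with
    -- m − k inversions.
    swap-transfers : ∀ a b p m → sumOver (λ w → δ (inv w) m * hookAt w p) (Words a b)
                         ≡ sumOver (λ w → δ (inv w + k) m * coHookAt w p) (Words a b)
    swap-transfers a b p m =
      trans (sym (sumOver-unique F (map (swapAt p) WS) WS (UniqueP.map⁺ inj (Words-unique a b)) (Words-unique a b) swapped⊆ ⊆swapped))
       (trans (sumOver-map WS (swapAt p) F) (sumOver-cong WS (λ w _ → swap-pointwise m w p)))
      where
      WS = Words a b
      F = λ w → δ (inv w) m * hookAt w p
      inj : ∀ {x y} → swapAt p x ≡ swapAt p y → x ≡ y
      inj {x} {y} e = trans (sym (swapAt-involutive p x)) (trans (cong (swapAt p) e) (swapAt-involutive p y))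
      swapped⊆ : ∀ z → z ∈ map (swapAt p) WS → z ∈ WS
      swapped⊆ z m with ∈-map⁻ (swapAt p) m
      ... | y , my , refl = let (e1 , e2) = Words-sound a b y my in
            Words-in a b (swapAt p y) (trans (ones-swapAt p y) e1) (trans (zeros-swapAt p y) e2)
      ⊆swapped : ∀ z → z ∈ WS → z ∈ map (swapAt p) WS
      ⊆swapped z m = let (e1 , e2) = Words-sound a b z m in
               subst (_∈ map (swapAt p) WS) (swapAt-involutive p z)
                 (∈-map⁺ (swapAt p) (Words-in a b (swapAt p z) (trans (ones-swapAt p z) e1) (trans (zeros-swapAt p z) e2)))


  -- divInd K d = [K ∣ d], the coefficient of x^d in 1/(1 − x^K)
  divInd : ℕ → ℕ → ℕ
  divInd k d = if ⌊ k ∣? d ⌋ then 1 else 0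

  divInd-0 : ∀ k → divInd k 0 ≡ 1
  divInd-0 k with k ∣? 0
  ... | yes _ = refl
  ... | no ¬p = ⊥-elim (¬p (k ∣0))

  divInd-small : ∀ k d → 0 < d → d < k → divInd k d ≡ 0
  divInd-small k (suc d) _ lt with k ∣? suc d
  ... | yes p = ⊥-elim (n≮n k (≤-<-trans (∣⇒≤ p) lt))
  ... | no _ = refl

  divInd-+ : ∀ k d → divInd k (k + d) ≡ divInd k d
  divInd-+ k d with k ∣? (k + d) | k ∣? d
  ... | yes _ | yes _ = refl
  ... | no _ | no _ = refl
  ... | yes p | no ¬q = ⊥-elim (¬q (∣m+n∣m⇒∣n p n∣n))
  ... | no ¬p | yes q = ⊥-elim (¬p (∣m∣n⇒∣m+n n∣n q))

  -- the coefficient of x^m in x^K/(1 − x^K)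
  lambertCoeff : ℕ → ℕ → ℕ
  lambertCoeff K m = sumBelow (suc m) (λ a → δ K a * divInd K (m ∸ a))

  lambertCoeff-small : ∀ K m → m < K → lambertCoeff K m ≡ 0
  lambertCoeff-small K m lt = sumBelow-0 (suc m) _ (λ a al → cong (_* divInd K (m ∸ a))
    (δ-ne K a (λ e → n≮n K (≤-<-trans (≤-reflexive e) (≤-<-trans (s≤s⁻¹ al) lt)))))

  lambertCoeff-big : ∀ K d → lambertCoeff K (K + d) ≡ divInd K d
  lambertCoeff-big K d =
    begin
      sumBelow (suc (K + d)) f
    ≡⟨ cong (λ z → sumBelow z f) (sym (+-suc K d)) ⟩
      sumBelow (K + suc d) f
    ≡⟨ sumBelow-split K (suc d) f ⟩
      sumBelow K f + sumBelow (suc d) (λ j → f (K + j))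
    ≡⟨ cong₂ _+_ (sumBelow-0 K f (λ a al → cong (_* divInd K (K + d ∸ a)) (δ-ne K a (λ e → n≮n a (subst (a <_) e al)))))
                 (sumBelow-first d (λ j → f (K + j))) ⟩
      0 + (f (K + 0) + sumBelow d (λ j → f (K + suc j)))
    ≡⟨ cong₂ (λ x y → x + y) (cong f (+-identityʳ K))
        (sumBelow-0 d (λ j → f (K + suc j)) (λ j _ → cong (_* divInd K (K + d ∸ (K + suc j)))
              (δ-ne K (K + suc j) (λ e → n≮n K (subst (K <_) (sym e) (m<m+n K (s≤s z≤n))))))) ⟩
      f K + 0
    ≡⟨ +-identityʳ _ ⟩
      δ K K * divInd K (K + d ∸ K)
    ≡⟨ cong₂ _*_ (δ-refl K) (cong (divInd K) (m+n∸m≡n K d)) ⟩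
      1 * divInd K d
    ≡⟨ *-identityˡ _ ⟩
      divInd K d
    ∎
    where open ≡-Reasoning
          f = λ a → δ K a * divInd K (K + d ∸ a)

  -- 1/(1 − x^K) = 1 + x^K/(1 − x^K) for K ≥ 1, coefficientwise
  divInd-lambertCoeff : ∀ K d → 0 < K → divInd K d ≡ δ d 0 + lambertCoeff K d
  divInd-lambertCoeff K zero pos = trans (divInd-0 K) (sym (cong (1 +_) (lambertCoeff-small K 0 pos)))
  divInd-lambertCoeff K (suc d) pos with K ≤? suc d
  ... | no nl = trans (divInd-small K (suc d) (s≤s z≤n) (≰⇒> nl)) (sym (lambertCoeff-small K (suc d) (≰⇒> nl)))
  ... | yes le =
    let d' = suc d ∸ K
        e : suc d ≡ K + d'
        e = sym (trans (+-comm K d') (m∸n+n≡m le))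
    in trans (cong (divInd K) e) (trans (divInd-+ K d') (trans (sym (lambertCoeff-big K d')) (cong (lambertCoeff K) (sym e))))

  -- pBounded b m: the coefficient of x^m in ∏_{j=1}^{b} 1/(1 − x^j), i.e. the
  -- number of partitions of m into parts of size at most b.
  pBounded : ℕ → ℕ → ℕ
  pBounded zero zero = 1
  pBounded zero (suc _) = 0
  pBounded (suc b) m = sumBelow (suc m) (λ i → pBounded b i * divInd (suc b) (m ∸ i))

  pBounded-0 : ∀ b → pBounded b 0 ≡ 1
  pBounded-0 zero = refl
  pBounded-0 (suc b) = trans (cong (λ z → z * divInd (suc b) 0) (pBounded-0 b)) (trans (*-identityˡ _) (divInd-0 (suc b)))

  -- parts larger than m cannot occur in a partition of m
  pBounded-low : ∀ b m → m ≤ b → pBounded (suc b) m ≡ pBounded b m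
  pBounded-low b m le =
    trans (cong (_+ pBounded b m * divInd (suc b) (m ∸ m))
       (sumBelow-0 m _ (λ i il →
          trans (cong (pBounded b i *_) (divInd-small (suc b) (m ∸ i) (m<n⇒0<n∸m il) (s≤s (≤-trans (m∸n≤m m i) le))))
                (*-zeroʳ (pBounded b i)))))
    (trans (cong (λ z → pBounded b m * divInd (suc b) z) (n∸n≡0 m)) (trans (cong (pBounded b m *_) (divInd-0 (suc b))) (*-identityʳ _)))

  -- p_{≤b+1}(b+1+m) = p_{≤b}(b+1+m) + p_{≤b+1}(m): either no part equals b + 1 or one can be removed
  pBounded-step : ∀ b m → pBounded (suc b) (suc b + m) ≡ pBounded b (suc b + m) + pBounded (suc b) m
  pBounded-step b m =
    begin
      sumBelow (suc (B + m)) f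
    ≡⟨ refl ⟩
      sumBelow (B + m) f + f (B + m)
    ≡⟨ cong (λ z → sumBelow z f + f (B + m)) (cong suc (+-comm b m)) ⟩
      sumBelow (suc m + b) f + f (B + m)
    ≡⟨ cong (_+ f (B + m)) (sumBelow-split (suc m) b f) ⟩
      sumBelow (suc m) f + sumBelow b (λ j → f (suc m + j)) + f (B + m)
    ≡⟨ cong₂ (λ x y → x + y + f (B + m)) (sumBelow-cong (suc m) (λ i il → cong (λ z → pBounded b i * divInd B z)
           (+-∸-assoc B (s≤s⁻¹ il))))
         (sumBelow-0 b _ (λ j jl → trans (cong (pBounded b (suc m + j) *_) (divInd-small B _ (pos j jl) (small j jl))) (*-zeroʳ (pBounded b (suc m + j))))) ⟩
      sumBelow (suc m) (λ i → pBounded b i * divInd B (B + (m ∸ i))) + 0 + f (B + m)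
    ≡⟨ cong₂ (λ x y → x + 0 + y) (sumBelow-cong (suc m) (λ i _ → cong (pBounded b i *_) (divInd-+ B (m ∸ i))))
            (trans (cong (λ z → pBounded b (B + m) * divInd B z) (n∸n≡0 (B + m))) (trans (cong (pBounded b (B + m) *_) (divInd-0 B)) (*-identityʳ _))) ⟩
      pBounded B m + 0 + pBounded b (B + m)
    ≡⟨ trans (cong (_+ pBounded b (B + m)) (+-identityʳ _)) (+-comm (pBounded B m) _) ⟩
      pBounded b (B + m) + pBounded B m
    ∎
    where
    open ≡-Reasoning
    B = suc b
    f = λ i → pBounded b i * divInd B (B + m ∸ i)
    eqj : ∀ j → j < b → B + m ∸ (suc m + j) ≡ b ∸ j
    eqj j jl = trans (cong (_∸ (suc m + j)) (cong suc (+-comm b m)))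
                     ([m+n]∸[m+o]≡n∸o (suc m) b j)
    pos : ∀ j → j < b → 0 < B + m ∸ (suc m + j)
    pos j jl = subst (0 <_) (sym (eqj j jl)) (m<n⇒0<n∸m jl)
    small : ∀ j → j < b → B + m ∸ (suc m + j) < B
    small j jl = subst (_< B) (sym (eqj j jl)) (s≤s (m∸n≤m b j))

  -- hence the number of partitions of m is p_{≤b}(m) for any b ≥ m
  pBounded-stable : ∀ b m → m ≤ b → pBounded b m ≡ pBounded m m
  pBounded-stable b m le with m ≟ b
  ... | yes refl = refl
  pBounded-stable (suc b) m le | no ne = trans (pBounded-low b m (s≤s⁻¹ (≤∧≢⇒< le ne))) (pBounded-stable b m (s≤s⁻¹ (≤∧≢⇒< le ne)))
  pBounded-stable zero m le | no ne = ⊥-elim (ne (n≤0⇒n≡0 le))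

  -- Words with a ones and b zeros are the partitions with at most a parts,
  -- each at most b; for m ≤ a the first bound is vacuous, so invCount
  -- satisfies the recursion of pBounded b.
  invCount : ℕ → ℕ → ℕ → ℕ
  invCount a b m = sumOver (λ w → δ (inv w) m) (Words a b)

  invCount-0b : ∀ b m → invCount 0 b m ≡ δ 0 m
  invCount-0b zero m = +-identityʳ _
  invCount-0b (suc b) m = trans (sumOver-map (Words 0 b) (false ∷_) (λ w → δ (inv w) m)) (invCount-0b b m)

  invCount-a0 : ∀ a m → invCount a 0 m ≡ δ 0 m
  invCount-a0 zero m = +-identityʳ _
  invCount-a0 (suc a) m = trans (sumOver-map (Words a 0) (true ∷_) (λ w → δ (inv w) m))
    (trans (sumOver-cong (Words a 0) (λ w mw → cong (λ z → δ (z + inv w) m) (proj₂ (Words-sound a 0 w mw)))) (invCount-a0 a m))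

  δ0≡pBounded0 : ∀ m → δ 0 m ≡ pBounded 0 m
  δ0≡pBounded0 zero = refl
  δ0≡pBounded0 (suc m) = refl

  -- split by the first letter: a leading 1 carries b + 1 inversions
  invCount-ss : ∀ a b m → invCount (suc a) (suc b) m ≡ sumOver (λ w → δ (suc b + inv w) m) (Words a (suc b)) + invCount (suc a) b m
  invCount-ss a b m = trans (sumOver-++ (map (true ∷_) (Words a (suc b))) (map (false ∷_) (Words (suc a) b)) F)
    (cong₂ _+_ (trans (sumOver-map (Words a (suc b)) (true ∷_) F)
                 (sumOver-cong (Words a (suc b)) (λ w mw → cong (λ z → δ (z + inv w) m) (proj₂ (Words-sound a (suc b) w mw)))))
               (sumOver-map (Words (suc a) b) (false ∷_) F))
    where F = λ w → δ (inv w) m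

  invCount≡pBounded : ∀ a b m → m ≤ a → invCount a b m ≡ pBounded b m
  invCount≡pBounded a zero m le = trans (invCount-a0 a m) (δ0≡pBounded0 m)
  invCount≡pBounded zero (suc b) m le rewrite n≤0⇒n≡0 le = trans (invCount-0b (suc b) 0) (sym (pBounded-0 (suc b)))
  invCount≡pBounded (suc a) (suc b) m le with suc b ≤? m
  ... | yes bl = subst (λ z → invCount (suc a) (suc b) z ≡ pBounded (suc b) z) (sym e) (invCount≡pBounded-yes (subst (_≤ suc a) e le))
    where
    m' = m ∸ suc b
    e : m ≡ suc b + m'
    e = sym (trans (+-comm (suc b) m') (m∸n+n≡m bl))
    invCount≡pBounded-yes : suc b + m' ≤ suc a → invCount (suc a) (suc b) (suc b + m') ≡ pBounded (suc b) (suc b + m')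
    invCount≡pBounded-yes le2 = trans (invCount-ss a b (suc b + m'))
      (trans (cong₂ _+_ (sumOver-cong (Words a (suc b)) (λ w _ → δ-+ (suc b) (inv w) m'))
                        (invCount≡pBounded (suc a) b (suc b + m') le2))
      (trans (cong (_+ pBounded b (suc b + m')) (invCount≡pBounded a (suc b) m' (≤-trans (m≤n+m m' b) (s≤s⁻¹ le2))))
       (trans (+-comm (pBounded (suc b) m') (pBounded b (suc b + m'))) (sym (pBounded-step b m')))))
  ... | no bl = trans (invCount-ss a b m)
     (trans (cong (_+ invCount (suc a) b m) (tooBig (Words a (suc b))))
       (trans (invCount≡pBounded (suc a) b m le) (sym (pBounded-low b m (s≤s⁻¹ (≰⇒> bl))))))
    where
    tooBig : ∀ ws → sumOver (λ w → δ (suc b + inv w) m) ws ≡ 0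
    tooBig [] = refl
    tooBig (w ∷ ws) rewrite δ-ne (suc b + inv w) m (λ e → bl (subst (suc b ≤_) e (m≤m+n (suc b) (inv w)))) = tooBig ws


  -- lambertWeight k m = Σ_i p(i) · [x^{m−i}] x^k/(1 − x^k) = Σ_{d ≥ 1} p(m − dk),
  -- so that the coefficient of x^m on the right-hand side is Σ_k k^{α+1} lambertWeight k m.
  lambertWeight : ℕ → ℕ → ℕ
  lambertWeight k m = sumBelow (suc m) (λ i → pBounded i i * lambertCoeff k (m ∸ i))

  lambertWeight-small : ∀ k m → m < k → lambertWeight k m ≡ 0
  lambertWeight-small k m lt = sumBelow-0 (suc m) _ (λ i il →
    trans (cong (pBounded i i *_) (lambertCoeff-small k (m ∸ i) (≤-<-trans (m∸n≤m m i) lt))) (*-zeroʳ (pBounded i i)))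

  -- the recursion W_k(k + m) = W_k(m) + p(m), from x^k/(1 − x^k) = x^k (1 + x^k/(1 − x^k))
  lambertWeight-step : ∀ t m → lambertWeight (suc t) (suc t + m) ≡ lambertWeight (suc t) m + pBounded m m
  lambertWeight-step t m =
    begin
      sumBelow (suc (k + m)) g
    ≡⟨ cong (λ z → sumBelow z g) (cong suc (+-comm k m)) ⟩
      sumBelow (suc m + k) g
    ≡⟨ sumBelow-split (suc m) k g ⟩
      sumBelow (suc m) g + sumBelow k (λ j → g (suc m + j))
    ≡⟨ cong₂ _+_ (sumBelow-cong (suc m) (λ i il → cong (pBounded i i *_)
            (trans (cong (lambertCoeff k) (+-∸-assoc k (s≤s⁻¹ il)))
                   (trans (lambertCoeff-big k (m ∸ i)) (divInd-lambertCoeff k (m ∸ i) (s≤s z≤n))))))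
         (sumBelow-0 k _ (λ j jl → trans (cong (pBounded (suc m + j) (suc m + j) *_) (lambertCoeff-small k _ (small j jl)))
                                         (*-zeroʳ (pBounded (suc m + j) (suc m + j))))) ⟩
      sumBelow (suc m) (λ i → pBounded i i * (δ (m ∸ i) 0 + lambertCoeff k (m ∸ i))) + 0
    ≡⟨ trans (+-identityʳ _) (trans (sumBelow-cong (suc m) (λ i _ → *-distribˡ-+ (pBounded i i) (δ (m ∸ i) 0) (lambertCoeff k (m ∸ i))))
           (sumBelow-+ (suc m) (λ i → pBounded i i * δ (m ∸ i) 0) (λ i → pBounded i i * lambertCoeff k (m ∸ i)))) ⟩
      sumBelow (suc m) (λ i → pBounded i i * δ (m ∸ i) 0) + lambertWeight k m
    ≡⟨ cong (_+ lambertWeight k m) (cong₂ _+_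
            (sumBelow-0 m _ (λ i il → trans (cong (pBounded i i *_) (δ-ne (m ∸ i) 0 (λ e → n≮n 0 (subst (0 <_) e (m<n⇒0<n∸m il)))))
                                             (*-zeroʳ (pBounded i i))))
            (trans (cong (λ z → pBounded m m * δ z 0) (n∸n≡0 m)) (trans (cong (pBounded m m *_) (δ-refl 0)) (*-identityʳ (pBounded m m))))) ⟩
      0 + pBounded m m + lambertWeight k m
    ≡⟨ +-comm (pBounded m m) (lambertWeight k m) ⟩
      lambertWeight k m + pBounded m m
    ∎
    where
    open ≡-Reasoning
    k = suc t
    g = λ i → pBounded i i * lambertCoeff k (k + m ∸ i)
    small : ∀ j → j < k → k + m ∸ (suc m + j) < k
    small j jl = subst (_< k) (sym (trans (cong (_∸ (m + j)) (+-comm t m)) ([m+n]∸[m+o]≡n∸o m t j))) (s≤s (m∸n≤m t j))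

  -- The hook recursion inside an N × N box.  hookTotal m counts the hooks of
  -- length k = t + 1 over all words in Words N N with m inversions, i.e.
  -- over all partitions of m (for m ≤ N every partition of m fits the box).
  module HookTotals (t N : ℕ) where
    open HookSwap t public

    Framed : List (List Bool)
    Framed = Words N N

    hookTotal : ℕ → ℕ
    hookTotal m = sumOver (λ w → δ (inv w) m * hooks w) Framed

    shapeCount : ℕ → ℕ
    shapeCount m = sumOver (λ w → δ (inv w) m) Framed

    length-framed : ∀ w → w ∈ Framed → length w ≡ N + N
    length-framed w mw = let (e1 , e2) = Words-sound N N w mw in trans (sym (ones+zeros w)) (cong₂ _+_ e1 e2)

    -- Hooks counted at each position are traded for cohooks of words with k
    -- fewer inversions (swap-transfers); those words have enough slack for
    -- coHooks≡hooks+k, since their inversion count plus k is m ≤ N.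
    hookTotal-eq : ∀ m → m ≤ N → hookTotal m ≡ sumOver (λ w → δ (inv w + k) m * (hooks w + k)) Framed
    hookTotal-eq m mN =
      begin
        sumOver (λ w → δ (inv w) m * hooks w) Framed
      ≡⟨ sumOver-cong Framed (λ w mw → trans (cong (δ (inv w) m *_) (trans (hooks-sum w) (cong (λ L → sumBelow L (hookAt w)) (length-framed w mw))))
                                      (sumBelow-*ˡ (N + N) (δ (inv w) m) (hookAt w))) ⟩
        sumOver (λ w → sumBelow (N + N) (λ p → δ (inv w) m * hookAt w p)) Framed
      ≡⟨ sumOver-sumBelow Framed (N + N) (λ w p → δ (inv w) m * hookAt w p) ⟩
        sumBelow (N + N) (λ p → sumOver (λ w → δ (inv w) m * hookAt w p) Framed)
      ≡⟨ sumBelow-cong (N + N) (λ p _ → swap-transfers N N p m) ⟩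
        sumBelow (N + N) (λ p → sumOver (λ w → δ (inv w + k) m * coHookAt w p) Framed)
      ≡⟨ sym (sumOver-sumBelow Framed (N + N) (λ w p → δ (inv w + k) m * coHookAt w p)) ⟩
        sumOver (λ w → sumBelow (N + N) (λ p → δ (inv w + k) m * coHookAt w p)) Framed
      ≡⟨ sumOver-cong Framed (λ w mw → trans (sym (sumBelow-*ˡ (N + N) (δ (inv w + k) m) (coHookAt w)))
             (cong (δ (inv w + k) m *_) (trans (cong (λ L → sumBelow L (coHookAt w)) (sym (length-framed w mw))) (sym (coHooks-sum w))))) ⟩
        sumOver (λ w → δ (inv w + k) m * coHooks w) Framed
      ≡⟨ sumOver-cong Framed (λ w mw → δ-case (inv w + k) m (coHooks w) (hooks w + k)
             (λ e → let (e1 , e2) = Words-sound N N w mw in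
               coHooks≡hooks+k w (subst (inv w + k ≤_) (sym e2) (subst (_≤ N) (sym e) mN))
                         (subst (inv w + k ≤_) (sym e1) (subst (_≤ N) (sym e) mN)))) ⟩
        sumOver (λ w → δ (inv w + k) m * (hooks w + k)) Framed
      ∎
      where open ≡-Reasoning

    hookTotal-rec : ∀ m → k + m ≤ N → hookTotal (k + m) ≡ hookTotal m + k * shapeCount m
    hookTotal-rec m le =
      begin
        hookTotal (k + m)
      ≡⟨ hookTotal-eq (k + m) le ⟩
        sumOver (λ w → δ (inv w + k) (k + m) * (hooks w + k)) Framed
      ≡⟨ sumOver-cong Framed (λ w _ → trans (cong (λ z → δ z (k + m) * (hooks w + k)) (+-comm (inv w) k))
             (trans (cong (_* (hooks w + k)) (δ-+ k (inv w) m)) (h (δ (inv w) m) (hooks w) k))) ⟩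
        sumOver (λ w → δ (inv w) m * hooks w + k * δ (inv w) m) Framed
      ≡⟨ sumOver-+ Framed (λ w → δ (inv w) m * hooks w) (λ w → k * δ (inv w) m) ⟩
        hookTotal m + sumOver (λ w → k * δ (inv w) m) Framed
      ≡⟨ cong (hookTotal m +_) (sym (sumOver-*ˡ Framed k (λ w → δ (inv w) m))) ⟩
        hookTotal m + k * shapeCount m
      ∎
      where open ≡-Reasoning
            h : ∀ i H k → i * (H + k) ≡ i * H + k * i
            h = solve-∀

    hookTotal-small : ∀ m → m < k → m ≤ N → hookTotal m ≡ 0
    hookTotal-small m lt mN = trans (hookTotal-eq m mN) (tooSmall Framed)
      where
      tooSmall : ∀ ws → sumOver (λ w → δ (inv w + k) m * (hooks w + k)) ws ≡ 0
      tooSmall [] = refl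
      tooSmall (w ∷ ws) rewrite δ-ne (inv w + k) m (λ e → n≮n m (<-≤-trans lt (subst (k ≤_) e (m≤n+m k (inv w))))) = tooSmall ws


    shapeCount-pBounded : ∀ m → m ≤ N → shapeCount m ≡ pBounded m m
    shapeCount-pBounded m le = trans (invCount≡pBounded N N m le) (pBounded-stable N m le)

    -- Solving the recursion: T(m) = k · Σ_{d ≥ 1} p(m − dk).  The argument f
    -- bounds m and makes the induction on m structural.
    hookTotal≡ : ∀ f m → m ≤ f → m ≤ N → hookTotal m ≡ k * lambertWeight k m
    hookTotal≡ f m mf mN with k ≤? m
    ... | no nl = trans (hookTotal-small m (≰⇒> nl) mN) (sym (trans (cong (k *_) (lambertWeight-small k m (≰⇒> nl))) (*-zeroʳ k)))
    hookTotal≡ zero m mf mN | yes kl with ≤-trans kl mf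
    ... | ()
    hookTotal≡ (suc f) m mf mN | yes kl =
      let m' = m ∸ k
          e : m ≡ k + m'
          e = sym (trans (+-comm k m') (m∸n+n≡m kl))
          m'f : m' ≤ f
          m'f = s≤s⁻¹ (≤-trans (s≤s (m≤n+m m' t)) (≤-trans (≤-reflexive (sym e)) mf))
          m'N : m' ≤ N
          m'N = ≤-trans (m≤n+m m' k) (≤-trans (≤-reflexive (sym e)) mN)
      in subst (λ z → hookTotal z ≡ k * lambertWeight k z) (sym e)
          (trans (hookTotal-rec m' (subst (_≤ N) e mN))
            (trans (cong₂ (λ a b → a + k * b) (hookTotal≡ f m' m'f m'N) (shapeCount-pBounded m' m'N))
              (trans (sym (*-distribˡ-+ k (lambertWeight k m') (pBounded m' m'))) (cong (k *_) (sym (lambertWeight-step t m'))))))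


  -- A partition μ (weakly decreasing) with
  -- parts at most Z is sent to boundaryWord Z μ t (t extra trailing ones);
  -- its inversions are its size, and its hook lengths are read off the word.

  conj-yes : ∀ j s rs → j ≤ s → conj (s ∷ rs) j ≡ suc (conj rs j)
  conj-yes j s rs le with j ≤ᵇ s | ≤⇒≤ᵇ le
  ... | true | _ = refl

  conj-no : ∀ j s rs → s < j → conj (s ∷ rs) j ≡ conj rs j
  conj-no j s rs lt with j ≤ᵇ s | ≤ᵇ⇒≤ j s
  ... | false | _ = refl
  ... | true | f = ⊥-elim (n≮n s (<-≤-trans lt (f _)))

  conj-0 : ∀ j rs → All (_< j) rs → conj rs j ≡ 0
  conj-0 j [] [] = refl
  conj-0 j (s ∷ rs) (p ∷ ps) = trans (conj-no j s rs p) (conj-0 j rs ps)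

  linked-all : ∀ {s rs} → Linked _≥_ (s ∷ rs) → All (_≤ s) rs
  linked-all l with Linked⇒AllPairs (λ p q → ≤-trans q p) l
  ... | s≥rs ∷ _ = s≥rs

  all-mono : ∀ {a b} {xs : List ℕ} → a ≤ b → All (_≤ a) xs → All (_≤ b) xs
  all-mono le [] = []
  all-mono le (p ∷ ps) = ≤-trans p le ∷ all-mono le ps

  -- the hook lengths of a partition, row by row, as listed by Defs.hookSum
  hookLengths : List ℕ → List ℕ
  hookLengths [] = []
  hookLengths (r ∷ rs) = map (λ j → suc ((r ∸ suc j) + conj rs (suc j))) (downFrom r) ++ hookLengths rs

  zeroPositions : List Bool → List ℕ
  zeroPositions [] = []
  zeroPositions (false ∷ w) = 0 ∷ map suc (zeroPositions w)
  zeroPositions (true ∷ w) = map suc (zeroPositions w)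

  wordHooks : List Bool → List ℕ
  wordHooks [] = []
  wordHooks (false ∷ w) = wordHooks w
  wordHooks (true ∷ w) = map suc (zeroPositions w) ++ wordHooks w

  -- each row r contributes a 1 preceded by the column steps down to r
  boundaryWord : ℕ → List ℕ → ℕ → List Bool
  boundaryWord Z [] t = replicate Z false ++ replicate t true
  boundaryWord Z (r ∷ rs) t = replicate (Z ∸ r) false ++ true ∷ boundaryWord r rs t

  ascending : ℕ → List ℕ
  ascending zero = []
  ascending (suc a) = 0 ∷ map suc (ascending a)

  zeroPositions-rep : ∀ a w → zeroPositions (replicate a false ++ w) ≡ ascending a ++ map (a +_) (zeroPositions w)
  zeroPositions-rep zero w = sym (map-id (zeroPositions w))
  zeroPositions-rep (suc a) w = cong (0 ∷_) (trans (cong (map suc) (zeroPositions-rep a w))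
     (trans (map-++ suc (ascending a) _) (cong (map suc (ascending a) ++_) (sym (map-∘ (zeroPositions w))))))

  zeroPositions-ones : ∀ t → zeroPositions (replicate t true) ≡ []
  zeroPositions-ones zero = refl
  zeroPositions-ones (suc t) = cong (map suc) (zeroPositions-ones t)

  wordHooks-rep : ∀ a w → wordHooks (replicate a false ++ w) ≡ wordHooks w
  wordHooks-rep zero w = refl
  wordHooks-rep (suc a) w = wordHooks-rep a w

  wordHooks-ones : ∀ t → wordHooks (replicate t true) ≡ []
  wordHooks-ones zero = refl
  wordHooks-ones (suc t) = cong₂ _++_ (cong (map suc) (zeroPositions-ones t)) (wordHooks-ones t)

  downFrom-+ : ∀ a b → downFrom (a + b) ≡ map (_+ b) (downFrom a) ++ downFrom b
  downFrom-+ zero b = refl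
  downFrom-+ (suc a) b = cong ((a + b) ∷_) (downFrom-+ a b)

  map-cong-downFrom : ∀ {f g : ℕ → ℕ} n → (∀ j → j < n → f j ≡ g j) → map f (downFrom n) ≡ map g (downFrom n)
  map-cong-downFrom zero h = refl
  map-cong-downFrom (suc n) h = cong₂ _∷_ (h n ≤-refl) (map-cong-downFrom n (λ j lt → h j (m≤n⇒m≤1+n lt)))

  ascending-down : ∀ r → map (λ j → r ∸ suc j) (downFrom r) ≡ ascending r
  ascending-down zero = refl
  ascending-down (suc r) = cong₂ _∷_ (n∸n≡0 r)
    (trans (map-cong-downFrom r (λ j lt → +-∸-assoc 1 lt)) (trans (map-∘ (downFrom r)) (cong (map suc) (ascending-down r))))

  -- The arm-plus-leg lengths of the first row r are the zero positions of the
  -- boundary word of the remaining rows (started at width r).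
  armLeg-zeroPositions : ∀ r rs t → All (_≤ r) rs → Linked _≥_ rs →
    map (λ j → (r ∸ suc j) + conj rs (suc j)) (downFrom r) ≡ zeroPositions (boundaryWord r rs t)
  armLeg-zeroPositions r [] t _ _ = trans (map-cong-downFrom r (λ j _ → +-identityʳ (r ∸ suc j)))
     (trans (ascending-down r) (sym (trans (zeroPositions-rep r (replicate t true))
       (trans (cong (λ z → ascending r ++ map (r +_) z) (zeroPositions-ones t)) (++-identityʳ (ascending r))))))
  armLeg-zeroPositions r (s ∷ rs) t (sr ∷ ar) lk =
    begin
      map pos (downFrom r)
    ≡⟨ cong (map pos) (trans (cong downFrom (sym (m∸n+n≡m sr))) (downFrom-+ (r ∸ s) s)) ⟩
      map pos (map (_+ s) (downFrom (r ∸ s)) ++ downFrom s)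
    ≡⟨ map-++ pos (map (_+ s) (downFrom (r ∸ s))) (downFrom s) ⟩
      map pos (map (_+ s) (downFrom (r ∸ s))) ++ map pos (downFrom s)
    ≡⟨ cong₂ _++_ (trans (sym (map-∘ (downFrom (r ∸ s)))) (trans (map-cong-downFrom (r ∸ s) part1) (ascending-down (r ∸ s))))
                  (trans (map-cong-downFrom s part2) (trans (map-∘ (downFrom s)) (trans (cong (map ((r ∸ s) +_)) (map-∘ (downFrom s)))
                     (cong (λ z → map ((r ∸ s) +_) (map suc z)) (armLeg-zeroPositions s rs t (linked-all lk) (linked-tail lk)))))) ⟩
      ascending (r ∸ s) ++ map ((r ∸ s) +_) (zeroPositions (true ∷ boundaryWord s rs t))
    ≡⟨ sym (zeroPositions-rep (r ∸ s) (true ∷ boundaryWord s rs t)) ⟩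
      zeroPositions (boundaryWord r (s ∷ rs) t)
    ∎
    where
    open ≡-Reasoning
    pos = λ j → (r ∸ suc j) + conj (s ∷ rs) (suc j)
    pos' = λ j → (s ∸ suc j) + conj rs (suc j)
    part1 : ∀ i → i < r ∸ s → pos (i + s) ≡ (r ∸ s) ∸ suc i
    part1 i lt = trans (cong ((r ∸ suc (i + s)) +_) (conj-0 (suc (i + s)) (s ∷ rs) (s≤s (m≤n+m s i) ∷ allLt (linked-all lk))))
       (trans (+-identityʳ _) (trans (cong (r ∸_) (trans (cong suc (+-comm i s)) (sym (+-suc s i)))) (sym (∸-+-assoc r s (suc i)))))
      where allLt : ∀ {xs} → All (_≤ s) xs → All (_< suc (i + s)) xs
            allLt [] = []
            allLt (q ∷ qs) = s≤s (≤-trans q (m≤n+m s i)) ∷ allLt qs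
    part2 : ∀ j → j < s → pos j ≡ (r ∸ s) + suc (pos' j)
    part2 j lt = trans (cong ((r ∸ suc j) +_) (conj-yes (suc j) s rs lt))
      (trans (cong (_+ suc (conj rs (suc j))) e1) (trans (+-assoc (r ∸ s) (s ∸ suc j) _) (cong ((r ∸ s) +_) (+-suc (s ∸ suc j) _))))
      where e1 : r ∸ suc j ≡ (r ∸ s) + (s ∸ suc j)
            e1 = trans (cong (_∸ suc j) (sym (m∸n+n≡m sr))) (trans (cong (_∸ suc j) (+-comm (r ∸ s) s))
                    (trans (+-∸-comm (r ∸ s) lt) (+-comm (s ∸ suc j) (r ∸ s))))

  hookLengths-boundaryWord : ∀ Z μ t → All (_≤ Z) μ → Linked _≥_ μ → hookLengths μ ≡ wordHooks (boundaryWord Z μ t)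
  hookLengths-boundaryWord Z [] t _ _ = sym (trans (wordHooks-rep Z (replicate t true)) (wordHooks-ones t))
  hookLengths-boundaryWord Z (r ∷ rs) t (rz ∷ _) lk = sym (trans (wordHooks-rep (Z ∸ r) (true ∷ boundaryWord r rs t))
    (cong₂ _++_ (trans (cong (map suc) (sym (armLeg-zeroPositions r rs t (linked-all lk) (linked-tail lk)))) (sym (map-∘ (downFrom r))))
                (sym (hookLengths-boundaryWord r rs t (linked-all lk) (linked-tail lk)))))

  count-zeroPositions : ∀ t w → count t (zeroPositions w) ≡ isZero (get w t)
  count-zeroPositions t [] = refl
  count-zeroPositions zero (false ∷ w) = cong suc (count-0-suc (zeroPositions w))
  count-zeroPositions (suc t) (false ∷ w) = trans (count-map-suc t (zeroPositions w)) (count-zeroPositions t w)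
  count-zeroPositions zero (true ∷ w) = count-0-suc (zeroPositions w)
  count-zeroPositions (suc t) (true ∷ w) = trans (count-map-suc t (zeroPositions w)) (count-zeroPositions t w)

  count-wordHooks : ∀ t w → HookSwap.hooks t w ≡ count (suc t) (wordHooks w)
  count-wordHooks t [] = refl
  count-wordHooks t (false ∷ w) = count-wordHooks t w
  count-wordHooks t (true ∷ w) = trans (cong₂ _+_ (+-identityʳ _) (count-wordHooks t w))
    (sym (trans (count-++ (suc t) (map suc (zeroPositions w)) (wordHooks w))
                (cong (_+ count (suc t) (wordHooks w)) (trans (count-map-suc t (zeroPositions w)) (count-zeroPositions t w)))))

  zeros-rep : ∀ a x → zeros (replicate a false ++ x) ≡ a + zeros x
  zeros-rep zero x = refl
  zeros-rep (suc a) x = cong suc (zeros-rep a x)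

  ones-rep : ∀ a x → ones (replicate a false ++ x) ≡ ones x
  ones-rep zero x = refl
  ones-rep (suc a) x = ones-rep a x

  inv-rep : ∀ a x → inv (replicate a false ++ x) ≡ inv x
  inv-rep zero x = refl
  inv-rep (suc a) x = inv-rep a x

  zeros-1s : ∀ t → zeros (replicate t true) ≡ 0
  zeros-1s zero = refl
  zeros-1s (suc t) = zeros-1s t

  ones-1s : ∀ t → ones (replicate t true) ≡ t
  ones-1s zero = refl
  ones-1s (suc t) = cong suc (ones-1s t)

  inv-1s : ∀ t → inv (replicate t true) ≡ 0
  inv-1s zero = refl
  inv-1s (suc t) = trans (cong₂ _+_ (zeros-1s t) (inv-1s t)) refl

  zeros-boundaryWord : ∀ Z μ t → All (_≤ Z) μ → Linked _≥_ μ → zeros (boundaryWord Z μ t) ≡ Z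
  zeros-boundaryWord Z [] t _ _ = trans (zeros-rep Z _) (trans (cong (Z +_) (zeros-1s t)) (+-identityʳ Z))
  zeros-boundaryWord Z (r ∷ rs) t (rz ∷ _) lk = trans (zeros-rep (Z ∸ r) _)
    (trans (cong ((Z ∸ r) +_) (zeros-boundaryWord r rs t (linked-all lk) (linked-tail lk))) (m∸n+n≡m rz))

  ones-boundaryWord : ∀ Z μ t → ones (boundaryWord Z μ t) ≡ length μ + t
  ones-boundaryWord Z [] t = trans (ones-rep Z _) (ones-1s t)
  ones-boundaryWord Z (r ∷ rs) t = trans (ones-rep (Z ∸ r) _) (cong suc (ones-boundaryWord r rs t))

  inv-boundaryWord : ∀ Z μ t → All (_≤ Z) μ → Linked _≥_ μ → inv (boundaryWord Z μ t) ≡ sum μ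
  inv-boundaryWord Z [] t _ _ = trans (inv-rep Z _) (inv-1s t)
  inv-boundaryWord Z (r ∷ rs) t _ lk = trans (inv-rep (Z ∸ r) _)
    (cong₂ _+_ (zeros-boundaryWord r rs t (linked-all lk) (linked-tail lk)) (inv-boundaryWord r rs t (linked-all lk) (linked-tail lk)))

  -- The inverse direction: wordShape reads the parts off a word (each 1
  -- contributes the number of zeros after it, when positive).
  prependPart : ℕ → List ℕ → List ℕ
  prependPart zero l = l
  prependPart (suc z) l = suc z ∷ l

  wordShape : List Bool → List ℕ
  wordShape [] = []
  wordShape (false ∷ w) = wordShape w
  wordShape (true ∷ w) = prependPart (zeros w) (wordShape w)

  wordShape-rep : ∀ a x → wordShape (replicate a false ++ x) ≡ wordShape x
  wordShape-rep zero x = refl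
  wordShape-rep (suc a) x = wordShape-rep a x

  wordShape-1s : ∀ t → wordShape (replicate t true) ≡ []
  wordShape-1s zero = refl
  wordShape-1s (suc t) rewrite zeros-1s t = wordShape-1s t

  wordShape-boundaryWord : ∀ Z μ t → All (0 <_) μ → All (_≤ Z) μ → Linked _≥_ μ → wordShape (boundaryWord Z μ t) ≡ μ
  wordShape-boundaryWord Z [] t _ _ _ = trans (wordShape-rep Z _) (wordShape-1s t)
  wordShape-boundaryWord Z (suc r ∷ rs) t (_ ∷ ps) _ lk = trans (wordShape-rep (Z ∸ suc r) _)
    (trans (cong (λ z → prependPart z (wordShape (boundaryWord (suc r) rs t))) (zeros-boundaryWord (suc r) rs t (linked-all lk) (linked-tail lk)))
      (cong (suc r ∷_) (wordShape-boundaryWord (suc r) rs t ps (linked-all lk) (linked-tail lk))))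

  wordShape-bound : ∀ w → All (_≤ zeros w) (wordShape w)
  wordShape-bound [] = []
  wordShape-bound (false ∷ w) = all-mono (n≤1+n _) (wordShape-bound w)
  wordShape-bound (true ∷ w) with zeros w | wordShape-bound w
  ... | zero | b = b
  ... | suc z | b = ≤-refl ∷ b

  wordShape-pos : ∀ w → All (0 <_) (wordShape w)
  wordShape-pos [] = []
  wordShape-pos (false ∷ w) = wordShape-pos w
  wordShape-pos (true ∷ w) with zeros w
  ... | zero = wordShape-pos w
  ... | suc z = s≤s z≤n ∷ wordShape-pos w

  linked-cons : ∀ {x xs} → All (_≤ x) xs → Linked _≥_ xs → Linked _≥_ (x ∷ xs)
  linked-cons [] [] = [-]
  linked-cons (p ∷ _) l = p ∷ l

  wordShape-linked : ∀ w → Linked _≥_ (wordShape w)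
  wordShape-linked [] = []
  wordShape-linked (false ∷ w) = wordShape-linked w
  wordShape-linked (true ∷ w) with zeros w | wordShape-bound w
  ... | zero | _ = wordShape-linked w
  ... | suc z | b = linked-cons b (wordShape-linked w)

  wordShape-sum : ∀ w → sum (wordShape w) ≡ inv w
  wordShape-sum [] = refl
  wordShape-sum (false ∷ w) = wordShape-sum w
  wordShape-sum (true ∷ w) with zeros w
  ... | zero = wordShape-sum w
  ... | suc z = cong (suc z +_) (wordShape-sum w)

  zeros0-wordShape : ∀ w → zeros w ≡ 0 → wordShape w ≡ []
  zeros0-wordShape [] _ = refl
  zeros0-wordShape (true ∷ w) e rewrite e = zeros0-wordShape w e

  zeros0-w : ∀ w → zeros w ≡ 0 → w ≡ replicate (ones w) true
  zeros0-w [] _ = refl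
  zeros0-w (true ∷ w) e = cong (true ∷_) (zeros0-w w e)

  boundaryWord-suc : ∀ Z μ t → All (_≤ Z) μ → boundaryWord (suc Z) μ t ≡ false ∷ boundaryWord Z μ t
  boundaryWord-suc Z [] t _ = refl
  boundaryWord-suc Z (r ∷ rs) t (rz ∷ _) rewrite +-∸-assoc 1 rz = refl

  wordShape-round : ∀ w → boundaryWord (zeros w) (wordShape w) (ones w ∸ length (wordShape w)) ≡ w
  wordShape-round [] = refl
  wordShape-round (false ∷ w) = trans (boundaryWord-suc (zeros w) (wordShape w) _ (wordShape-bound w)) (cong (false ∷_) (wordShape-round w))
  wordShape-round (true ∷ w) with zeros w in eq
  ... | zero rewrite zeros0-wordShape w eq = cong (true ∷_) (sym (zeros0-w w eq))
  ... | suc z rewrite n∸n≡0 z = cong (true ∷_) (trans (cong (λ Z → boundaryWord Z (wordShape w) (ones w ∸ length (wordShape w))) (sym eq)) (wordShape-round w))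

  part-bound : ∀ μ → All (_≤ sum μ) μ
  part-bound [] = []
  part-bound (r ∷ rs) = m≤m+n r (sum rs) ∷ all-mono (m≤n+m (sum rs) r) (part-bound rs)

  part-len : ∀ μ → All (0 <_) μ → length μ ≤ sum μ
  part-len [] [] = z≤n
  part-len (r ∷ rs) (p ∷ ps) = +-mono-≤ p (part-len rs ps)

  -- For any duplicate-free list L of all partitions of n, boundary words in
  -- the n × n box give a bijection between L and the words of Words n n with
  -- n inversions, matching hook lengths.  Hence the boxes of hook length
  -- t + 1 over L number hookTotal n.
  module Transfer (t n : ℕ) (L : List (List ℕ)) (uL : Unique L) (hL : ∀ μ → (μ ∈ L) ⇔ IsPartitionOf n μ) where
    open HookTotals t n

    word : List ℕ → List Bool
    word μ = boundaryWord n μ (n ∸ length μ)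

    module _ (μ : List ℕ) (pμ : IsPartitionOf n μ) where
      lk : Linked _≥_ μ
      lk = proj₁ pμ
      pos : All (0 <_) μ
      pos = proj₁ (proj₂ pμ)
      sm : sum μ ≡ n
      sm = proj₂ (proj₂ pμ)
      bnd : All (_≤ n) μ
      bnd = subst (λ z → All (_≤ z) μ) sm (part-bound μ)
      lenle : length μ ≤ n
      lenle = subst (length μ ≤_) sm (part-len μ pos)
      word-inv : inv (word μ) ≡ n
      word-inv = trans (inv-boundaryWord n μ _ bnd lk) sm
      word-in-box : word μ ∈ Words n n
      word-in-box = Words-in n n (word μ) (trans (ones-boundaryWord n μ _) (trans (+-comm (length μ) _) (m∸n+n≡m lenle))) (zeros-boundaryWord n μ _ bnd lk)
      wordShape-word : wordShape (word μ) ≡ μ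
      wordShape-word = wordShape-boundaryWord n μ _ pos bnd lk
      hooks-word : count (suc t) (hookLengths μ) ≡ hooks (word μ)
      hooks-word = trans (cong (count (suc t)) (hookLengths-boundaryWord n μ _ bnd lk)) (sym (count-wordHooks t (word μ)))

    isPartition : ∀ {μ} → μ ∈ L → IsPartitionOf n μ
    isPartition {μ} m = Equivalence.to (hL μ) m

    hasSize? : ∀ w → Dec (inv w ≡ n)
    hasSize? w = inv w ≟ n

    Sized : List (List Bool)
    Sized = filter hasSize? (Words n n)

    F : List Bool → ℕ
    F w = δ (inv w) n * hooks w

    hooks-via-words : sumOver (λ μ → count (suc t) (hookLengths μ)) L ≡ hookTotal n
    hooks-via-words =
      begin
        sumOver (λ μ → count (suc t) (hookLengths μ)) L
      ≡⟨ sumOver-cong L (λ μ m → trans (hooks-word μ (isPartition m))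
           (sym (trans (cong (_* hooks (word μ)) (trans (cong (λ z → δ z n) (word-inv μ (isPartition m))) (δ-refl n))) (+-identityʳ _)))) ⟩
        sumOver (λ μ → F (word μ)) L
      ≡⟨ sym (sumOver-map L word F) ⟩
        sumOver F (map word L)
      ≡⟨ sumOver-unique F (map word L) Sized (map-unique-on word L inj uL) (UniqueP.filter⁺ hasSize? (Words-unique n n)) words⊆ ⊆words ⟩
        sumOver F Sized
      ≡⟨ sumOver-filter hasSize? F (Words n n) (λ y np → cong (_* hooks y) (δ-ne (inv y) n np)) ⟩
        hookTotal n
      ∎
      where
      open ≡-Reasoning
      inj : ∀ x y → x ∈ L → y ∈ L → word x ≡ word y → x ≡ y
      inj x y mx my e = trans (sym (wordShape-word x (isPartition mx))) (trans (cong wordShape e) (wordShape-word y (isPartition my)))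
      words⊆ : ∀ z → z ∈ map word L → z ∈ Sized
      words⊆ z m with ∈-map⁻ word m
      ... | μ , mμ , refl = ∈-filter⁺ hasSize? (word-in-box μ (isPartition mμ)) (word-inv μ (isPartition mμ))
      ⊆words : ∀ z → z ∈ Sized → z ∈ map word L
      ⊆words z m =
        let (mz , iz) = ∈-filter⁻ hasSize? m
            (e1 , e2) = Words-sound n n z mz
            pz : IsPartitionOf n (wordShape z)
            pz = wordShape-linked z , wordShape-pos z , trans (wordShape-sum z) iz
            rt : word (wordShape z) ≡ z
            rt = trans (cong₂ (λ a b → boundaryWord a (wordShape z) (b ∸ length (wordShape z))) (sym e2) (sym e1)) (wordShape-round z)
        in subst (_∈ map word L) rt (∈-map⁺ word (Equivalence.from (hL (wordShape z)) pz))


  allHookLengths : List (List ℕ) → List ℕ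
  allHookLengths [] = []
  allHookLengths (μ ∷ L) = hookLengths μ ++ allHookLengths L

  count-allHookLengths : ∀ x (L : List (List ℕ)) →
    count x (allHookLengths L) ≡ sumOver (λ μ → count x (hookLengths μ)) L
  count-allHookLengths x [] = refl
  count-allHookLengths x (μ ∷ L) =
    trans (count-++ x (hookLengths μ) (allHookLengths L)) (cong (count x (hookLengths μ) +_) (count-allHookLengths x L))

  hookLengths-pos : ∀ μ → All (0 <_) (hookLengths μ)
  hookLengths-pos [] = []
  hookLengths-pos (r ∷ rs) = AllP.++⁺ (sucs-pos (downFrom r)) (hookLengths-pos rs)
    where
    sucs-pos : ∀ (js : List ℕ) → All (0 <_) (map (λ j → suc ((r ∸ suc j) + conj rs (suc j))) js)
    sucs-pos [] = []
    sucs-pos (j ∷ js) = s≤s z≤n ∷ sucs-pos js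

  allHookLengths-pos : ∀ L → All (0 <_) (allHookLengths L)
  allHookLengths-pos [] = []
  allHookLengths-pos (μ ∷ L) = AllP.++⁺ (hookLengths-pos μ) (allHookLengths-pos L)

  hookMultiplicity : ∀ t n (L : List (List ℕ)) → Unique L → (∀ μ → (μ ∈ L) ⇔ IsPartitionOf n μ) →
    count (suc t) (allHookLengths L) ≡ suc t * lambertWeight (suc t) n
  hookMultiplicity t n L uL hL =
    begin
      count (suc t) (allHookLengths L)
    ≡⟨ count-allHookLengths (suc t) L ⟩
      sumOver (λ μ → count (suc t) (hookLengths μ)) L
    ≡⟨ Transfer.hooks-via-words t n L uL hL ⟩
      HookTotals.hookTotal t n n
    ≡⟨ HookTotals.hookTotal≡ t n n n ≤-refl ≤-refl ⟩
      suc t * lambertWeight (suc t) n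
    ∎
    where open ≡-Reasoning

import Data.Nat as N
open import Data.Nat using (zero; suc; _∸_)
import Data.Nat.Properties as NP
open import Data.Bool using (Bool; true; false; if_then_else_)
open import Data.List using ([]; _∷_; _++_; map; downFrom)
open import Data.List.Relation.Unary.All as All using (All; []; _∷_)
open import Data.List.Relation.Unary.Linked using (Linked) renaming (tail to linked-tail)
open import Data.Nat.ListAction using (sum)
open import Data.Product using (proj₁)
open import Function.Bundles using (Equivalence)
import Relation.Binary.PropositionalEquality as Eq
open import Relation.Nullary using (yes; no)
import Algebra.Properties.CommutativeSemigroup as CSP
open Combinatorics

module RingSums {c ℓ} (R : CommutativeRing c ℓ) where
  open CommutativeRing R
  open import Relation.Binary.Reasoning.Setoid setoid
  open CSP +-commutativeSemigroup using (interchange)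

  ΣT : ℕ → (ℕ → Carrier) → Carrier
  ΣT = sumTo R

  nat : ℕ → Carrier
  nat = natR R

  natR-+ : ∀ a b → nat (a N.+ b) ≈ nat a + nat b
  natR-+ zero b = sym (+-identityˡ _)
  natR-+ (suc a) b = trans (+-congˡ (natR-+ a b)) (sym (+-assoc _ _ _))

  natR-* : ∀ a b → nat (a N.* b) ≈ nat a * nat b
  natR-* zero b = sym (zeroˡ _)
  natR-* (suc a) b = begin
      nat (b N.+ a N.* b)
    ≈⟨ natR-+ b (a N.* b) ⟩
      nat b + nat (a N.* b)
    ≈⟨ +-cong (sym (*-identityˡ _)) (natR-* a b) ⟩
      1# * nat b + nat a * nat b
    ≈⟨ sym (distribʳ _ _ _) ⟩
      (1# + nat a) * nat b
    ∎

  natR-1 : nat 1 ≈ 1#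
  natR-1 = +-identityʳ 1#

  natR-if : ∀ (b : Bool) → (if b then 1# else 0#) ≈ nat (if b then 1 else 0)
  natR-if true = sym natR-1
  natR-if false = refl

  sumTo-cong : ∀ n {f g : ℕ → Carrier} → (∀ i → i N.< n → f i ≈ g i) → ΣT n f ≈ ΣT n g
  sumTo-cong zero h = refl
  sumTo-cong (suc n) h = +-cong (sumTo-cong n (λ i lt → h i (NP.m≤n⇒m≤1+n lt))) (h n NP.≤-refl)

  sumTo-+ : ∀ n f g → ΣT n (λ i → f i + g i) ≈ ΣT n f + ΣT n g
  sumTo-+ zero f g = sym (+-identityˡ _)
  sumTo-+ (suc n) f g = trans (+-congʳ (sumTo-+ n f g)) (interchange _ _ _ _)

  sumTo-*ˡ : ∀ n x f → x * ΣT n f ≈ ΣT n (λ i → x * f i)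
  sumTo-*ˡ zero x f = zeroʳ x
  sumTo-*ˡ (suc n) x f = trans (distribˡ x _ _) (+-congʳ (sumTo-*ˡ n x f))

  sumTo-*ʳ : ∀ n x f → ΣT n f * x ≈ ΣT n (λ i → f i * x)
  sumTo-*ʳ zero x f = zeroˡ x
  sumTo-*ʳ (suc n) x f = trans (distribʳ x _ _) (+-congʳ (sumTo-*ʳ n x f))

  sumTo-0 : ∀ n f → (∀ i → i N.< n → f i ≈ 0#) → ΣT n f ≈ 0#
  sumTo-0 zero f h = refl
  sumTo-0 (suc n) f h = trans (+-cong (sumTo-0 n f (λ i lt → h i (NP.m≤n⇒m≤1+n lt))) (h n NP.≤-refl)) (+-identityʳ 0#)

  sumTo-swap : ∀ a b (f : ℕ → ℕ → Carrier) → ΣT a (λ i → ΣT b (f i)) ≈ ΣT b (λ j → ΣT a (λ i → f i j))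
  sumTo-swap zero b f = sym (sumTo-0 b _ (λ _ _ → refl))
  sumTo-swap (suc a) b f = trans (+-congʳ (sumTo-swap a b f)) (sym (sumTo-+ b (λ j → ΣT a (λ i → f i j)) (f a)))

  sumTo-natR : ∀ n f → ΣT n (λ i → nat (f i)) ≈ nat (sumBelow n f)
  sumTo-natR zero f = refl
  sumTo-natR (suc n) f = trans (+-congʳ (sumTo-natR n f)) (sym (natR-+ (sumBelow n f) (f n)))

  sumTo-ext : ∀ a b f → (∀ i → a N.≤ i → f i ≈ 0#) → ΣT (a N.+ b) f ≈ ΣT a f
  sumTo-ext a zero f h = reflexive (Eq.cong (λ z → ΣT z f) (NP.+-identityʳ a))
  sumTo-ext a (suc b) f h = trans (reflexive (Eq.cong (λ z → ΣT z f) (NP.+-suc a b)))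
    (trans (+-cong (sumTo-ext a b f h) (h (a N.+ b) (NP.m≤m+n a b))) (+-identityʳ _))

  sumTo-δ : ∀ K x (G : ℕ → Carrier) → x N.< K → ΣT K (λ t → nat (δ t x) * G t) ≈ G x
  sumTo-δ (suc K) x G lt with x N.≟ K
  ... | yes Eq.refl = trans (+-cong (sumTo-0 K _ (λ i il → trans (*-congʳ (reflexive (Eq.cong nat (δ-ne i x (λ e → NP.<-irrefl e il))))) (zeroˡ _)))
                               (trans (*-congʳ (reflexive (Eq.cong nat (δ-refl x)))) (trans (*-congʳ natR-1) (*-identityˡ _))))
                        (+-identityˡ _)
  ... | no ne = trans (+-cong (sumTo-δ K x G (NP.≤∧≢⇒< (NP.≤-pred lt) ne))
                        (trans (*-congʳ (reflexive (Eq.cong nat (δ-ne K x (λ e → ne (Eq.sym e)))))) (zeroˡ _))) (+-identityʳ _)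

  sumOverR : (ℕ → Carrier) → List ℕ → Carrier
  sumOverR g [] = 0#
  sumOverR g (x ∷ xs) = g x + sumOverR g xs

  sumOverR-++ : ∀ g xs ys → sumOverR g (xs ++ ys) ≈ sumOverR g xs + sumOverR g ys
  sumOverR-++ g [] ys = sym (+-identityˡ _)
  sumOverR-++ g (x ∷ xs) ys = trans (+-congˡ (sumOverR-++ g xs ys)) (sym (+-assoc _ _ _))

  sumOverR-by-multiplicity : ∀ g K xs → All (N._≤ K) xs → All (0 N.<_) xs →
           sumOverR g xs ≈ ΣT K (λ t → nat (count (suc t) xs) * g (suc t))
  sumOverR-by-multiplicity g K [] _ _ = sym (sumTo-0 K _ (λ _ _ → zeroˡ _))
  sumOverR-by-multiplicity g K (suc x ∷ xs) (b ∷ bs) (_ ∷ ps) = begin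
      g (suc x) + sumOverR g xs
    ≈⟨ +-cong (sym (sumTo-δ K x (λ t → g (suc t)) b)) (sumOverR-by-multiplicity g K xs bs ps) ⟩
      ΣT K (λ t → nat (δ t x) * g (suc t)) + ΣT K (λ t → nat (count (suc t) xs) * g (suc t))
    ≈⟨ sym (sumTo-+ K _ _) ⟩
      ΣT K (λ t → nat (δ t x) * g (suc t) + nat (count (suc t) xs) * g (suc t))
    ≈⟨ sumTo-cong K (λ t _ → trans (sym (distribʳ _ _ _))
         (*-congʳ (trans (+-congʳ (reflexive (Eq.cong nat (Eq.sym (δ-suc t x))))) (sym (natR-+ (δ (suc t) (suc x)) (count (suc t) xs)))))) ⟩
      ΣT K (λ t → nat (count (suc t) (suc x ∷ xs)) * g (suc t))
    ∎

module HookSide {c ℓ} (R : CommutativeRing c ℓ) (g : ℕ → CommutativeRing.Carrier R) where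
  open CommutativeRing R
  open import Relation.Binary.Reasoning.Setoid setoid
  open RingSums R

  HSF : List ℕ → ℕ → List ℕ → Carrier
  HSF μ i rs = hookSumFrom R μ i rs g

  -- Dropping the first row r of μ leaves the hooks of the later rows
  -- unchanged: each column of a later row gains exactly that row r in μ'.
  shift : ∀ r rs i xs → All (N._≤ r) xs → HSF (r ∷ rs) (suc i) xs ≈ HSF rs i xs
  shift r rs i [] _ = refl
  shift r rs i (x ∷ xs) (xr ∷ ax) = +-cong
    (sumTo-cong x (λ j lt → reflexive (Eq.cong (λ z → g (suc ((x ∸ suc j) N.+ (z ∸ suc i)))) (conj-yes (suc j) r rs (NP.≤-trans lt xr)))))
    (shift r rs (suc i) xs ax)

  sumTo-sumOverR : ∀ r (F : ℕ → ℕ) → ΣT r (λ j → g (F j)) ≈ sumOverR g (map F (downFrom r))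
  sumTo-sumOverR zero F = refl
  sumTo-sumOverR (suc r) F = trans (+-congʳ (sumTo-sumOverR r F)) (+-comm _ _)

  hookSum-hookLengths : ∀ μ → Linked N._≥_ μ → hookSum R μ g ≈ sumOverR g (hookLengths μ)
  hookSum-hookLengths [] _ = refl
  hookSum-hookLengths (r ∷ rs) lk = begin
      HSF (r ∷ rs) 1 (r ∷ rs)
    ≈⟨ +-cong (sumTo-cong r (λ j lt → reflexive (Eq.cong (λ z → g (suc ((r ∸ suc j) N.+ (z ∸ 1)))) (conj-yes (suc j) r rs lt))))
              (shift r rs 1 rs (linked-all lk)) ⟩
      ΣT r (λ j → g (suc ((r ∸ suc j) N.+ conj rs (suc j)))) + hookSum R rs g
    ≈⟨ +-cong (sumTo-sumOverR r (λ j → suc ((r ∸ suc j) N.+ conj rs (suc j)))) (hookSum-hookLengths rs (linked-tail lk)) ⟩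
      sumOverR g (map (λ j → suc ((r ∸ suc j) N.+ conj rs (suc j))) (downFrom r)) + sumOverR g (hookLengths rs)
    ≈⟨ sym (sumOverR-++ g (map (λ j → suc ((r ∸ suc j) N.+ conj rs (suc j))) (downFrom r)) (hookLengths rs)) ⟩
      sumOverR g (hookLengths (r ∷ rs))
    ∎

  hookSumList-allHookLengths : ∀ L → All (Linked N._≥_) L → hookSumList R L g ≈ sumOverR g (allHookLengths L)
  hookSumList-allHookLengths [] _ = refl
  hookSumList-allHookLengths (μ ∷ L) (l ∷ ls) =
    trans (+-cong (hookSum-hookLengths μ l) (hookSumList-allHookLengths L ls))
          (sym (sumOverR-++ g (hookLengths μ) (allHookLengths L)))

module SeriesSide {c ℓ} (R : CommutativeRing c ℓ) where
  open CommutativeRing R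
  open import Relation.Binary.Reasoning.Setoid setoid
  open RingSums R

  one-pBounded : ∀ m → one R m ≈ nat (pBounded 0 m)
  one-pBounded zero = sym natR-1
  one-pBounded (suc m) = refl

  geo-divInd : ∀ k d → geo R k d ≈ nat (divInd k d)
  geo-divInd k d = natR-if _

  mono-δ : ∀ k a → mono R k a ≈ nat (δ k a)
  mono-δ k a = natR-if _

  prodGeo-pBounded : ∀ b m → prodGeo R b m ≈ nat (pBounded b m)
  prodGeo-pBounded zero m = one-pBounded m
  prodGeo-pBounded (suc b) m = begin
      ΣT (suc m) (λ i → prodGeo R b i * geo R (suc b) (m ∸ i))
    ≈⟨ sumTo-cong (suc m) (λ i _ → trans (*-cong (prodGeo-pBounded b i) (geo-divInd (suc b) (m ∸ i))) (sym (natR-* (pBounded b i) (divInd (suc b) (m ∸ i))))) ⟩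
      ΣT (suc m) (λ i → nat (pBounded b i N.* divInd (suc b) (m ∸ i)))
    ≈⟨ sumTo-natR (suc m) _ ⟩
      nat (pBounded (suc b) m)
    ∎

  lambertTerm-lambertCoeff : ∀ g K m → lambertTerm R g K m ≈ nat (lambertCoeff K m) * (nat K * g K)
  lambertTerm-lambertCoeff g K m = begin
      ΣT (suc m) (λ a → mono R K a * ((nat K * g K) * geo R K (m ∸ a)))
    ≈⟨ sumTo-cong (suc m) (λ a _ → trans (*-cong (mono-δ K a) (*-congˡ (geo-divInd K (m ∸ a))))
          (trans (*-congˡ (*-comm _ _)) (trans (sym (*-assoc _ _ _)) (*-congʳ (sym (natR-* (δ K a) (divInd K (m ∸ a)))))))) ⟩
      ΣT (suc m) (λ a → nat (δ K a N.* divInd K (m ∸ a)) * (nat K * g K))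
    ≈⟨ sym (sumTo-*ʳ (suc m) (nat K * g K) _) ⟩
      ΣT (suc m) (λ a → nat (δ K a N.* divInd K (m ∸ a))) * (nat K * g K)
    ≈⟨ *-congʳ (sumTo-natR (suc m) _) ⟩
      nat (lambertCoeff K m) * (nat K * g K)
    ∎


  rhsCoeff-form : ∀ g n → rhsCoeff R g n ≈ ΣT n (λ j → nat (suc j N.* lambertWeight (suc j) n) * g (suc j))
  rhsCoeff-form g n = begin
      ΣT (suc n) (λ i → partGF R i * lambertSum R g (n ∸ i))
    ≈⟨ sumTo-cong (suc n) (λ i il → *-cong (prodGeo-pBounded i i)
          (trans (sumTo-cong (n ∸ i) (λ j _ → lambertTerm-lambertCoeff g (suc j) (n ∸ i))) (extend i (NP.≤-pred il)))) ⟩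
      ΣT (suc n) (λ i → nat (pBounded i i) * ΣT n (H i))
    ≈⟨ sumTo-cong (suc n) (λ i _ → trans (sumTo-*ˡ n (nat (pBounded i i)) (H i)) (sumTo-cong n (λ j _ → term i j))) ⟩
      ΣT (suc n) (λ i → ΣT n (λ j → nat (X i j) * g (suc j)))
    ≈⟨ sumTo-swap (suc n) n (λ i j → nat (X i j) * g (suc j)) ⟩
      ΣT n (λ j → ΣT (suc n) (λ i → nat (X i j) * g (suc j)))
    ≈⟨ sumTo-cong n (λ j _ → trans (sym (sumTo-*ʳ (suc n) (g (suc j)) (λ i → nat (X i j))))
                                   (*-congʳ (trans (sumTo-natR (suc n) (λ i → X i j)) (reflexive (Eq.cong nat (weighted j)))))) ⟩
      ΣT n (λ j → nat (suc j N.* lambertWeight (suc j) n) * g (suc j))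
    ∎
    where
    H : ℕ → ℕ → Carrier
    H i j = nat (lambertCoeff (suc j) (n ∸ i)) * (nat (suc j) * g (suc j))
    X : ℕ → ℕ → ℕ
    X i j = pBounded i i N.* lambertCoeff (suc j) (n ∸ i) N.* suc j
    -- the Lambert terms with j ≥ n − i do not contribute to x^{n−i}
    extend : ∀ i → i N.≤ n → ΣT (n ∸ i) (H i) ≈ ΣT n (H i)
    extend i le = sym (trans (reflexive (Eq.cong (λ z → ΣT z (H i)) (Eq.sym (NP.m∸n+n≡m le))))
                   (sumTo-ext (n ∸ i) i (H i) (λ j jl → trans (*-congʳ (reflexive (Eq.cong nat (lambertCoeff-small (suc j) (n ∸ i) (N.s≤s jl))))) (zeroˡ _))))
    term : ∀ i j → nat (pBounded i i) * H i j ≈ nat (X i j) * g (suc j)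
    term i j = begin
        nat (pBounded i i) * (nat (lambertCoeff (suc j) (n ∸ i)) * (nat (suc j) * g (suc j)))
      ≈⟨ sym (*-assoc _ _ _) ⟩
        nat (pBounded i i) * nat (lambertCoeff (suc j) (n ∸ i)) * (nat (suc j) * g (suc j))
      ≈⟨ sym (*-assoc _ _ _) ⟩
        nat (pBounded i i) * nat (lambertCoeff (suc j) (n ∸ i)) * nat (suc j) * g (suc j)
      ≈⟨ *-congʳ (sym (trans (natR-* (pBounded i i N.* lambertCoeff (suc j) (n ∸ i)) (suc j)) (*-congʳ (natR-* (pBounded i i) (lambertCoeff (suc j) (n ∸ i)))))) ⟩
        nat (X i j) * g (suc j)
      ∎
    weighted : ∀ j → sumBelow (suc n) (λ i → X i j) Eq.≡ suc j N.* lambertWeight (suc j) n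
    weighted j = Eq.trans (sumBelow-cong (suc n) (λ i _ → NP.*-comm _ (suc j))) (Eq.sym (sumBelow-*ˡ (suc n) (suc j) _))

-- Both sides equal Σ_{t < K} (t + 1) · W_{t+1}(n) · pw(t + 1):
-- the left one by grouping boxes by hook length (HookSide, RingSums) and
-- counting them (hookMultiplicity), the right one by rhsCoeff-form; K is any
-- bound on the hook lengths that is at least n.
theorem6p2 : ∀ {c ℓ} (R : CommutativeRing c ℓ)
    (pw : ℕ → CommutativeRing.Carrier R)
    (n : ℕ) (L : List (List ℕ)) →
    Unique L → (∀ μ → (μ ∈ L) ⇔ IsPartitionOf n μ) →
    CommutativeRing._≈_ R (hookSumList R L pw) (rhsCoeff R pw n)
theorem6p2 R pw n L uL hL = begin
    hookSumList R L pw
  ≈⟨ HookSide.hookSumList-allHookLengths R pw L decreasing ⟩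
    sumOverR pw (allHookLengths L)
  ≈⟨ sumOverR-by-multiplicity pw K (allHookLengths L) hooksBounded (allHookLengths-pos L) ⟩
    ΣT K (λ t → nat (count (suc t) (allHookLengths L)) * pw (suc t))
  ≈⟨ sumTo-cong K (λ t _ → *-congʳ (reflexive (Eq.cong nat (hookMultiplicity t n L uL hL)))) ⟩
    ΣT K (λ t → nat (suc t N.* lambertWeight (suc t) n) * pw (suc t))
  ≈⟨ sumTo-ext n (sum (allHookLengths L)) _ (λ t n≤t → trans (*-congʳ (reflexive (Eq.cong nat (noWeight t n≤t)))) (zeroˡ _)) ⟩
    ΣT n (λ t → nat (suc t N.* lambertWeight (suc t) n) * pw (suc t))
  ≈⟨ sym (SeriesSide.rhsCoeff-form R pw n) ⟩
    rhsCoeff R pw n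
  ∎
  where
  open CommutativeRing R
  open import Relation.Binary.Reasoning.Setoid setoid
  open RingSums R
  K : ℕ
  K = n N.+ sum (allHookLengths L)
  decreasing : All (Linked N._≥_) L
  decreasing = All.tabulate (λ {μ} μ∈L → proj₁ (Equivalence.to (hL μ) μ∈L))
  hooksBounded : All (N._≤ K) (allHookLengths L)
  hooksBounded = all-mono (NP.m≤n+m _ n) (part-bound (allHookLengths L))
  noWeight : ∀ t → n N.≤ t → suc t N.* lambertWeight (suc t) n Eq.≡ 0
  noWeight t n≤t = Eq.trans (Eq.cong (suc t N.*_) (lambertWeight-small (suc t) n (N.s≤s n≤t))) (NP.*-zeroʳ (suc t))
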